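{- Let $f\ge 3$ and $k\ge 1$. For each $S\in\mathcal P^0_{f,k}$, let $\Psi(S)$ be the unique diagram of length $f+1$ whose adjacency matrix equals $\mathbf B(S)$. Then $\Psi$ is a well-defined surjective order-preserving map from $(\mathcal P^0_{f,k},\preceq)$ to $(\mathcal S_{f+1,k},\subseteq)$, and its restriction to $\mathcal R^0_{f,k}$ is a poset isomorphism from $(\mathcal R^0_{f,k},\preceq)$ onto $(\mathcal S_{f+1,k},\subseteq)$.
   Context: A diagram of length $n$ is a simple graph on sites $\{1,\dots,n\}$ whose edges (arcs) are pairs $(s_1,s_2)$ with $s_1<s_2$ and $1<s_2-s_1<n-1$, supported by $s_1,s_2$; it is non-trivial if it has at least one arc. Its adjacency matrix $\mathbf A(S)$ is the symmetric $n\times n$ $(0,1)$-matrix with $(i,j)$ entry $1$ iff $(i,j)$ or $(j,i)$ is an arc. A diagram is binary if it is non-trivial and each site supports at most one arc. A site is free if it supports no arc; $s$ is covered by $(s_1,s_2)$ if $s_1<s<s_2$. Arcs $(s_1,s_2),(s_1',s_2')$ cross if $s_1<s_1'<s_2<s_2'$ or $s_1'<s_1<s_2'<s_2$; a diagram is $k$-noncrossing if it has no $k+1$ pairwise crossing arcs. A diagram is proper if it is binary, each arc covers at least one free site, and no arc covers all free sites. If $u_1<\dots<u_f$ are the free sites, $u_0=0$, $u_{f+1}=n+1$, the $i$-th block $B_i$ is the set of sites $s$ with $u_{i-1}<s<u_i$. The block matrix $\mathbf B(S)=(b_{i,j})$ is the symmetric $(f+1)\times(f+1)$ matrix where, for $i\ne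 j$, $b_{i,j}$ is the number of arcs with one supporting site in $B_i$ and the other in $B_j$, and $b_{i,i}$ is the number of arcs with both supporting sites in $B_i$. A diagram is regular if it is binary and no two crossing arcs have supporting sites lying in a common block. The tautology number of a diagram $S$ is $\sum_{i<j}\max\{0,b_{i,j}-1\}+\sum_{i}b_{i,i+1}$ where $(b_{i,j})=\mathbf B(S)$. $\mathcal P^0_{f,k}$ is the set of proper $k$-noncrossing diagrams with exactly $f$ free sites and tautology number $0$, and $\mathcal R^0_{f,k}$ its subset of regular diagrams. Suppressing an arc of a binary diagram deletes the arc and its two supporting sites and relabels remaining sites consecutively in order; $S\preceq S'$ means $S$ is obtained from $S'$ by a (possibly empty) sequence of arc suppressions. $\mathcal S_{n,k}$ is the set of non-trivial (not necessarily binary) $k$-noncrossing diagrams of length $n$, ordered by $S\subseteq S'$ iff every arc of $S$ is an arc of $S'$. -}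

module Defs where

open import Data.Nat using (ℕ; zero; suc; _+_; _∸_; _≤_; _<_; _≡ᵇ_; _<ᵇ_)
open import Data.Bool using (Bool; true; false; _∧_; _∨_; if_then_else_)
open import Data.Product using (_×_; _,_; Σ; ∃; proj₁; proj₂)
open import Data.Sum using (_⊎_)
open import Data.List using (List; []; _∷_; length; map)
open import Data.Bool.ListAction using (any)
open import Data.List.Relation.Unary.All using (All)
open import Data.List.Relation.Unary.Linked using (Linked)
open import Data.List.Relation.Unary.AllPairs using (AllPairs)
open import Data.List.Membership.Propositional using (_∈_)
open import Data.List.Relation.Binary.Subset.Propositional using (_⊆_)
open import Relation.Binary.PropositionalEquality using (_≡_; _≢_)
open import Relation.Nullary using (¬_)

-- Sites are the naturals 1..n.  An arc (s₁ , s₂) is a pair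
-- with s₁ < s₂.  A diagram (a set of arcs) is represented canonically
-- by the strictly lexicographically increasing list of its arcs.

Arc : Set
Arc = ℕ × ℕ

ValidArc : ℕ → Arc → Set
ValidArc n (a , b) = (1 ≤ a) × (a < b) × (b ≤ n) × (1 < b ∸ a) × (b ∸ a < n ∸ 1)

_<ₐ_ : Arc → Arc → Set
(a , b) <ₐ (c , d) = (a < c) ⊎ ((a ≡ c) × (b < d))

IsDiagram : ℕ → List Arc → Set
IsDiagram n S = All (ValidArc n) S × Linked _<ₐ_ S

NonTrivial : List Arc → Set
NonTrivial S = 1 ≤ length S

deg : List Arc → ℕ → ℕ
deg [] s = 0
deg ((a , b) ∷ S) s =
  (if a ≡ᵇ s then 1 else 0) + (if b ≡ᵇ s then 1 else 0) + deg S s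

Binary : List Arc → Set
Binary S = NonTrivial S × (∀ s → deg S s ≤ 1)

Free : ℕ → List Arc → ℕ → Set
Free n S s = (1 ≤ s) × (s ≤ n) × (deg S s ≡ 0)

Covered : ℕ → Arc → Set
Covered s (a , b) = (a < s) × (s < b)

Supports : ℕ → Arc → Set
Supports s (a , b) = (s ≡ a) ⊎ (s ≡ b)

Cross : Arc → Arc → Set
Cross (a , b) (c , d) = ((a < c) × (c < b) × (b < d)) ⊎ ((c < a) × (a < d) × (d < b))

KNoncrossing : ℕ → List Arc → Set
KNoncrossing k S = (L : List Arc) → All (_∈ S) L → AllPairs Cross L → length L ≤ k

Proper : ℕ → List Arc → Set
Proper n S =
  Binary S
  × (∀ α → α ∈ S → ∃ λ s → Free n S s × Covered s α)
  × (∀ α → α ∈ S → ¬ (∀ s → Free n S s → Covered s α))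

sites : ℕ → List ℕ
sites zero = []
sites (suc n) = suc n ∷ sites n

countℕ : (ℕ → Bool) → List ℕ → ℕ
countℕ p [] = 0
countℕ p (x ∷ xs) = (if p x then 1 else 0) + countℕ p xs

nFree : ℕ → List Arc → ℕ
nFree n S = countℕ (λ s → deg S s ≡ᵇ 0) (sites n)

nFreeBelow : ℕ → List Arc → ℕ → ℕ
nFreeBelow n S s = countℕ (λ u → (deg S u ≡ᵇ 0) ∧ (u <ᵇ s)) (sites n)

-- index i of the block B_i containing the (non-free) site s
-- (u_{i-1} < s < u_i, with u_0 = 0, u_{f+1} = n + 1)
block : ℕ → List Arc → ℕ → ℕ
block n S s = suc (nFreeBelow n S s)

countA : (Arc → Bool) → List Arc → ℕ
countA p [] = 0
countA p (x ∷ xs) = (if p x then 1 else 0) + countA p xs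

-- block matrix entry b_{i,j} (blocks indexed 1..f+1): number of arcs
-- with one supporting site in B_i and the other in B_j (for i = j: both in B_i)
blockMatrix : ℕ → List Arc → ℕ → ℕ → ℕ
blockMatrix n S i j = countA (λ { (a , b) →
    ((block n S a ≡ᵇ i) ∧ (block n S b ≡ᵇ j))
  ∨ ((block n S a ≡ᵇ j) ∧ (block n S b ≡ᵇ i)) }) S

adjMatrix : List Arc → ℕ → ℕ → ℕ
adjMatrix T i j =
  if any (λ { (c , d) → ((c ≡ᵇ i) ∧ (d ≡ᵇ j)) ∨ ((c ≡ᵇ j) ∧ (d ≡ᵇ i)) }) T
  then 1 else 0

sumTo : ℕ → (ℕ → ℕ) → ℕ
sumTo zero g = 0
sumTo (suc m) g = sumTo m g + g (suc m)

-- tautology number: Σ_{1≤i<j≤f+1} max{0, b_ij - 1} + Σ_{i=1}^{f} b_{i,i+1}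
tautology : ℕ → List Arc → ℕ
tautology n S =
  sumTo (suc f) (λ j → sumTo (j ∸ 1) (λ i → blockMatrix n S i j ∸ 1))
  + sumTo f (λ i → blockMatrix n S i (suc i))
  where f = nFree n S

Regular : ℕ → List Arc → Set
Regular n S =
  Binary S
  × (∀ α β → α ∈ S → β ∈ S → Cross α β →
       ∀ x y → Supports x α → Supports y β → block n S x ≢ block n S y)

P0 : ℕ → ℕ → ℕ → List Arc → Set
P0 f k n S =
  IsDiagram n S × Proper n S × KNoncrossing k S
  × (nFree n S ≡ f) × (tautology n S ≡ 0)

R0 : ℕ → ℕ → ℕ → List Arc → Set
R0 f k n S = P0 f k n S × Regular n S

SD : ℕ → ℕ → List Arc → Set
SD m k T = IsDiagram m T × NonTrivial T × KNoncrossing k T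

AdjEq : ℕ → List Arc → (ℕ → ℕ → ℕ) → Set
AdjEq m T M = ∀ i j → 1 ≤ i → i ≤ m → 1 ≤ j → j ≤ m → adjMatrix T i j ≡ M i j

-- new label of site s after deleting sites a < b
shift : ℕ → ℕ → ℕ → ℕ
shift a b s = s ∸ ((if a <ᵇ s then 1 else 0) + (if b <ᵇ s then 1 else 0))

removeArc : Arc → List Arc → List Arc
removeArc α [] = []
removeArc (a , b) ((c , d) ∷ S) =
  if (c ≡ᵇ a) ∧ (d ≡ᵇ b) then removeArc (a , b) S
  else (c , d) ∷ removeArc (a , b) S

-- suppress the arc α of S (diagram data only; length drops by 2)
suppress : Arc → List Arc → List Arc
suppress (a , b) S = map (λ { (c , d) → (shift a b c , shift a b d) }) (removeArc (a , b) S)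

data _≼_ : ℕ × List Arc → ℕ × List Arc → Set where
  ≼-refl : ∀ {x} → x ≼ x
  ≼-step : ∀ {x n' S' α} → α ∈ S' → x ≼ (n' ∸ 2 , suppress α S') → x ≼ (n' , S')

-- Ψ sends a diagram to the graph of its blocks.  For S ∈ 𝒫⁰ the tautology condition bounds every
-- entry of 𝐁(S) by 1 and kills the entries joining adjacent blocks, so 𝐁(S) is the adjacency matrix
-- of a diagram of length f + 1, unique because a diagram is the sorted list of its arcs.  Suppressing
-- an arc only lowers entries of 𝐁(S), so Ψ is monotone.
--
-- Counting free sites and endpoints gives, for every site x,  x = (block of x) + #(endpoints before x).
-- In a regular diagram of tautology number 0 the endpoints inside a block come in an order that only
-- depends on the blocks of their partners, so Ψ(S) determines every site and hence S.  Conversely,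
-- placing the endpoints of any T ∈ 𝒮 in that order at those positions gives a regular preimage.  If
-- Ψ(S) ⊆ Ψ(S'), suppressing from S' one by one the arcs whose pair of blocks is missing from Ψ(S)
-- stays inside ℛ⁰ and ends at a diagram with the same image as S, that is, at S.

module Submission where

open import Data.Nat using (ℕ; zero; suc; pred; _+_; _*_; _∸_; _≤_; _<_; _⊓_; _≡ᵇ_; _<ᵇ_; z≤n; s≤s)
open import Data.Nat.Properties
open import Algebra.Properties.CommutativeSemigroup +-commutativeSemigroup using (interchange; x∙yz≈y∙xz)
open import Data.Bool using (Bool; true; false; _∧_; _∨_; if_then_else_; T)
import Data.Bool.Properties as BP
open import Data.Bool.ListAction using (any)
open import Data.Empty using (⊥-elim)
open import Data.Unit using (tt)
open import Data.Product using (_×_; _,_; Σ; ∃; proj₁; proj₂)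
open import Data.Product.Properties using (≡-dec)
open import Data.Sum using (_⊎_; inj₁; inj₂)
open import Data.List using (List; []; _∷_; length; map; _++_; filter; filterᵇ)
open import Data.List.Properties using (length-map)
open import Data.List.Relation.Unary.Any using (here; there)
open import Data.List.Relation.Unary.All using (All; []; _∷_; tabulate; all?)
import Data.List.Relation.Unary.All as All
open import Data.List.Relation.Unary.All.Properties using (¬All⇒Any¬)
open import Data.List.Relation.Unary.AllPairs using (AllPairs; []; _∷_)
import Data.List.Relation.Unary.AllPairs as AP
import Data.List.Relation.Unary.AllPairs.Properties as APP
open import Data.List.Relation.Unary.Linked using (Linked)
open import Data.List.Relation.Unary.Linked.Properties using (Linked⇒AllPairs; AllPairs⇒Linked)
open import Data.List.Relation.Unary.Unique.Propositional using (Unique)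
open import Data.List.Membership.Propositional using (_∈_; find)
open import Data.List.Membership.Propositional.Properties using (∈-map⁺; ∈-map⁻; ∈-++⁺ˡ; ∈-++⁺ʳ; ∈-++⁻; ∈-filter⁺; ∈-filter⁻)
open import Data.List.Membership.DecPropositional (≡-dec _≟_ _≟_) using (_∈?_)
open import Data.List.Relation.Binary.Subset.Propositional using (_⊆_)
open import Function using (_∘_)
open import Function.Bundles using (_⇔_; mk⇔)
open import Relation.Binary.PropositionalEquality
open import Relation.Binary.Definitions using (tri<; tri≈; tri>)
open import Relation.Nullary using (¬_; yes; no)
open import Relation.Nullary.Reflects using (Reflects; invert)
open import Relation.Nullary.Decidable using (T?; Dec; does; proof; dec-true; dec-false; _⊎-dec_; _×-dec_)
open import Defs

χ : Bool → ℕ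
χ b = if b then 1 else 0

χ≤1 : ∀ b → χ b ≤ 1
χ≤1 true = s≤s z≤n
χ≤1 false = z≤n

χ-mono : ∀ {b b'} → (b ≡ true → b' ≡ true) → χ b ≤ χ b'
χ-mono {false} h = z≤n
χ-mono {true} h rewrite h refl = ≤-refl

χ-pos⇒true : ∀ {b} → 1 ≤ χ b → b ≡ true
χ-pos⇒true {true} _ = refl

∨-∧-true⇒ : ∀ x y z w → (x ∧ y) ∨ (z ∧ w) ≡ true → (x ≡ true × y ≡ true) ⊎ (z ≡ true × w ≡ true)
∨-∧-true⇒ true true z w _ = inj₁ (refl , refl)
∨-∧-true⇒ true false true true _ = inj₂ (refl , refl)
∨-∧-true⇒ false y true true _ = inj₂ (refl , refl)

≡ᵇ-view : ∀ m n → ((m ≡ᵇ n) ≡ true × m ≡ n) ⊎ ((m ≡ᵇ n) ≡ false × m ≢ n)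
≡ᵇ-view m n with m ≡ᵇ n in eq
... | true = inj₁ (refl , ≡ᵇ⇒≡ m n (subst T (sym eq) tt))
... | false = inj₂ (refl , λ e → subst T eq (≡⇒≡ᵇ m n e))

<ᵇ-view : ∀ m n → ((m <ᵇ n) ≡ true × m < n) ⊎ ((m <ᵇ n) ≡ false × n ≤ m)
<ᵇ-view m n with m <ᵇ n in eq
... | true = inj₁ (refl , <ᵇ⇒< m n (subst T (sym eq) tt))
... | false = inj₂ (refl , ≮⇒≥ (λ lt → subst T eq (<⇒<ᵇ lt)))

≡ᵇ-refl : ∀ m → (m ≡ᵇ m) ≡ true
≡ᵇ-refl zero = refl
≡ᵇ-refl (suc m) = ≡ᵇ-refl m

≡⇒≡ᵇ-true : ∀ {m n} → m ≡ n → (m ≡ᵇ n) ≡ true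
≡⇒≡ᵇ-true {m} refl = ≡ᵇ-refl m

≢⇒≡ᵇ-false : ∀ {m n} → m ≢ n → (m ≡ᵇ n) ≡ false
≢⇒≡ᵇ-false {m} {n} ne with ≡ᵇ-view m n
... | inj₁ (_ , e) = ⊥-elim (ne e)
... | inj₂ (e , _) = e

≡ᵇ-true⇒≡ : ∀ {m n} → (m ≡ᵇ n) ≡ true → m ≡ n
≡ᵇ-true⇒≡ {m} {n} e = ≡ᵇ⇒≡ m n (subst T (sym e) tt)

<⇒<ᵇ-true : ∀ {m n} → m < n → (m <ᵇ n) ≡ true
<⇒<ᵇ-true {m} {n} lt with <ᵇ-view m n
... | inj₁ (e , _) = e
... | inj₂ (_ , ge) = ⊥-elim (<⇒≱ lt ge)

≥⇒<ᵇ-false : ∀ {m n} → n ≤ m → (m <ᵇ n) ≡ false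
≥⇒<ᵇ-false {m} {n} ge with <ᵇ-view m n
... | inj₁ (_ , lt) = ⊥-elim (<⇒≱ lt ge)
... | inj₂ (e , _) = e

<ᵇ-cong : ∀ {x y x' y'} → (x < y → x' < y') → (x' < y' → x < y) → (x <ᵇ y) ≡ (x' <ᵇ y')
<ᵇ-cong {x} {y} f g with <ᵇ-view x y
... | inj₁ (e , p) = trans e (sym (<⇒<ᵇ-true (f p)))
... | inj₂ (e , p) = trans e (sym (≥⇒<ᵇ-false (≮⇒≥ (λ q → <⇒≱ (g q) p))))

≡ᵇ-cong : ∀ {x y x' y'} → (x ≡ y → x' ≡ y') → (x' ≡ y' → x ≡ y) → (x ≡ᵇ y) ≡ (x' ≡ᵇ y')
≡ᵇ-cong {x} {y} f g with ≡ᵇ-view x y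
... | inj₁ (e , p) = trans e (sym (≡⇒≡ᵇ-true (f p)))
... | inj₂ (e , p) = trans e (sym (≢⇒≡ᵇ-false (λ q → p (g q))))

module _ {A : Set} where

  ∑ : List A → (A → ℕ) → ℕ
  ∑ [] g = 0
  ∑ (x ∷ xs) g = g x + ∑ xs g

  ∑-+ : ∀ xs (g h : A → ℕ) → ∑ xs (λ x → g x + h x) ≡ ∑ xs g + ∑ xs h
  ∑-+ [] g h = refl
  ∑-+ (x ∷ xs) g h rewrite ∑-+ xs g h = interchange (g x) (h x) (∑ xs g) (∑ xs h)

  ∑-cong : ∀ xs {g h : A → ℕ} → (∀ x → x ∈ xs → g x ≡ h x) → ∑ xs g ≡ ∑ xs h
  ∑-cong [] e = refl
  ∑-cong (x ∷ xs) e = cong₂ _+_ (e x (here refl)) (∑-cong xs (λ y p → e y (there p)))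

  ∑-mono : ∀ xs {g h : A → ℕ} → (∀ x → x ∈ xs → g x ≤ h x) → ∑ xs g ≤ ∑ xs h
  ∑-mono [] e = z≤n
  ∑-mono (x ∷ xs) e = +-mono-≤ (e x (here refl)) (∑-mono xs (λ y p → e y (there p)))

  ∑-zero : ∀ xs (g : A → ℕ) → (∀ x → x ∈ xs → g x ≡ 0) → ∑ xs g ≡ 0
  ∑-zero [] g e = refl
  ∑-zero (x ∷ xs) g e rewrite e x (here refl) = ∑-zero xs g (λ y p → e y (there p))

  term≤∑ : ∀ xs (g : A → ℕ) {x} → x ∈ xs → g x ≤ ∑ xs g
  term≤∑ (y ∷ xs) g (here refl) = m≤m+n (g y) _
  term≤∑ (y ∷ xs) g (there p) = ≤-trans (term≤∑ xs g p) (m≤n+m _ (g y))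

  ∑-pos⇒ : ∀ xs (g : A → ℕ) → 1 ≤ ∑ xs g → ∃ λ x → x ∈ xs × 1 ≤ g x
  ∑-pos⇒ (y ∷ xs) g p with g y in eq
  ... | zero = let (x , m , q) = ∑-pos⇒ xs g p in x , there m , q
  ... | suc k = y , here refl , subst (1 ≤_) (sym eq) (s≤s z≤n)

  two-terms≤∑ : ∀ xs (g : A → ℕ) {x y} → x ∈ xs → y ∈ xs → x ≢ y → 1 ≤ g x → 1 ≤ g y → 2 ≤ ∑ xs g
  two-terms≤∑ (z ∷ xs) g (here refl) (here refl) ne _ _ = ⊥-elim (ne refl)
  two-terms≤∑ (z ∷ xs) g (here refl) (there q) ne gx gy = +-mono-≤ gx (≤-trans gy (term≤∑ xs g q))
  two-terms≤∑ (z ∷ xs) g (there p) (here refl) ne gx gy = +-mono-≤ gy (≤-trans gx (term≤∑ xs g p))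
  two-terms≤∑ (z ∷ xs) g (there p) (there q) ne gx gy = ≤-trans (two-terms≤∑ xs g p q ne gx gy) (m≤n+m _ (g z))

  ∑≤1 : ∀ xs (g : A → ℕ) → Unique xs → (∀ x → x ∈ xs → g x ≤ 1) →
        (∀ {x y} → x ∈ xs → y ∈ xs → 1 ≤ g x → 1 ≤ g y → x ≡ y) → ∑ xs g ≤ 1
  ∑≤1 [] g u le inj = z≤n
  ∑≤1 (z ∷ xs) g (z∉xs ∷ u) le inj with g z in eq
  ... | zero = ∑≤1 xs g u (λ x m → le x (there m)) (λ p q → inj (there p) (there q))
  ... | suc k = subst (λ s → suc k + s ≤ 1) (sym (∑-zero xs g others))
                  (subst (_≤ 1) (trans eq (sym (+-identityʳ (suc k)))) (le z (here refl)))
    where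
    others : ∀ y → y ∈ xs → g y ≡ 0
    others y m with g y in e
    ... | zero = refl
    ... | suc _ = ⊥-elim (All.lookup z∉xs m (inj (here refl) (there m) (subst (1 ≤_) (sym eq) (s≤s z≤n))
                                                                      (subst (1 ≤_) (sym e) (s≤s z≤n))))

  ∑-<⇒ : ∀ xs (g h : A → ℕ) → ∑ xs g < ∑ xs h → ∃ λ x → x ∈ xs × g x < h x
  ∑-<⇒ (y ∷ xs) g h lt with g y <? h y
  ... | yes p = y , here refl , p
  ... | no np = let (x , m , q) = ∑-<⇒ xs g h (+-cancelˡ-< (h y) _ _ (≤-<-trans (+-monoˡ-≤ (∑ xs g) (≮⇒≥ np)) lt))
                in x , there m , q

  ∑-< : ∀ xs (g h : A → ℕ) → (∀ x → x ∈ xs → g x ≤ h x) → ∀ {x} → x ∈ xs → g x < h x → ∑ xs g < ∑ xs h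
  ∑-< (y ∷ xs) g h le (here refl) lt = +-mono-<-≤ lt (∑-mono xs (λ z m → le z (there m)))
  ∑-< (y ∷ xs) g h le (there p) lt = +-mono-≤-< (le y (here refl)) (∑-< xs g h (λ z m → le z (there m)) p lt)

  ∑-const : ∀ xs c → ∑ xs (λ _ → c) ≡ c * length xs
  ∑-const [] c = sym (*-zeroʳ c)
  ∑-const (x ∷ xs) c = trans (cong (c +_) (∑-const xs c)) (sym (*-suc c (length xs)))

  ∑1≡length : ∀ xs → ∑ xs (λ _ → 1) ≡ length xs
  ∑1≡length xs = trans (∑-const xs 1) (*-identityˡ (length xs))

  ∑-scale : ∀ xs (c : ℕ) (g : A → ℕ) → ∑ xs (λ x → c * g x) ≡ c * ∑ xs g
  ∑-scale [] c g = sym (*-zeroʳ c)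
  ∑-scale (x ∷ xs) c g rewrite ∑-scale xs c g = sym (*-distribˡ-+ c (g x) (∑ xs g))

  private
    remove : ∀ {x : A} {xs} → x ∈ xs → List A
    remove {xs = _ ∷ xs} (here _) = xs
    remove {xs = y ∷ xs} (there p) = y ∷ remove p

    ∑-remove : ∀ {x xs} (p : x ∈ xs) (g : A → ℕ) → ∑ xs g ≡ g x + ∑ (remove p) g
    ∑-remove (here refl) g = refl
    ∑-remove {x} {y ∷ xs} (there p) g rewrite ∑-remove p g = x∙yz≈y∙xz (g y) (g x) _

    ∈-remove⁺ : ∀ {x xs} (p : x ∈ xs) {z} → z ∈ xs → z ≢ x → z ∈ remove p
    ∈-remove⁺ (here refl) (here refl) ne = ⊥-elim (ne refl)
    ∈-remove⁺ (here refl) (there q) ne = q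
    ∈-remove⁺ (there p) (here refl) ne = here refl
    ∈-remove⁺ (there p) (there q) ne = there (∈-remove⁺ p q ne)

    ∈-remove⁻ : ∀ {x xs} (p : x ∈ xs) {z} → z ∈ remove p → z ∈ xs
    ∈-remove⁻ (here refl) q = there q
    ∈-remove⁻ (there p) (here refl) = here refl
    ∈-remove⁻ (there p) (there q) = there (∈-remove⁻ p q)

    All-remove : ∀ {P : A → Set} {x xs} (p : x ∈ xs) → All P xs → All P (remove p)
    All-remove (here refl) (_ ∷ a) = a
    All-remove (there p) (px ∷ a) = px ∷ All-remove p a

    Unique-remove : ∀ {x xs} (p : x ∈ xs) → Unique xs → Unique (remove p)
    Unique-remove (here refl) (_ ∷ u) = u
    Unique-remove (there p) (a ∷ u) = All-remove p a ∷ Unique-remove p u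

    ∉-remove : ∀ {x xs} (p : x ∈ xs) → Unique xs → ∀ {z} → z ∈ remove p → z ≢ x
    ∉-remove (here refl) (a ∷ u) q refl = All.lookup a q refl
    ∉-remove (there p) (a ∷ u) (here refl) refl = All.lookup a p refl
    ∉-remove (there p) (a ∷ u) (there q) e = ∉-remove p u q e

  ∑-cong-∈ : ∀ xs ys → Unique xs → Unique ys → (∀ {z} → z ∈ xs → z ∈ ys) → (∀ {z} → z ∈ ys → z ∈ xs) →
             ∀ (g : A → ℕ) → ∑ xs g ≡ ∑ ys g
  ∑-cong-∈ [] [] _ _ _ _ g = refl
  ∑-cong-∈ [] (y ∷ ys) _ _ _ ys⊆xs g with ys⊆xs (here refl)
  ... | ()
  ∑-cong-∈ (x ∷ xs) ys (x∉xs ∷ ux) uy xs⊆ys ys⊆xs g =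
    let p = xs⊆ys (here refl) in
    trans (cong (g x +_) (∑-cong-∈ xs (remove p) ux (Unique-remove p uy)
            (λ q → ∈-remove⁺ p (xs⊆ys (there q)) (λ e → All.lookup x∉xs q (sym e)))
            (λ q → tail (ys⊆xs (∈-remove⁻ p q)) (∉-remove p uy q)) g))
          (sym (∑-remove p g))
    where
    tail : ∀ {z} → z ∈ x ∷ xs → z ≢ x → z ∈ xs
    tail (here e) ne = ⊥-elim (ne e)
    tail (there q) ne = q

∑-swap : ∀ {A B : Set} (xs : List A) (ys : List B) (F : A → B → ℕ) →
         ∑ xs (λ x → ∑ ys (F x)) ≡ ∑ ys (λ y → ∑ xs (λ x → F x y))
∑-swap [] ys F = sym (∑-zero ys _ (λ _ _ → refl))
∑-swap (x ∷ xs) ys F rewrite ∑-swap xs ys F = sym (∑-+ ys (F x) (λ y → ∑ xs (λ x → F x y)))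

∑-map : ∀ {A B : Set} (h : A → B) (xs : List A) (g : B → ℕ) → ∑ (map h xs) g ≡ ∑ xs (λ x → g (h x))
∑-map h [] g = refl
∑-map h (x ∷ xs) g = cong (g (h x) +_) (∑-map h xs g)

Unique-map⁺ : ∀ {A B : Set} {xs : List A} (g : A → B) → Unique xs →
              (∀ {x y} → x ∈ xs → y ∈ xs → g x ≡ g y → x ≡ y) → Unique (map g xs)
Unique-map⁺ {xs = []} g u inj = []
Unique-map⁺ {xs = x ∷ xs} g (x∉xs ∷ u) inj = head x∉xs (λ m → m) ∷ Unique-map⁺ g u (λ p q → inj (there p) (there q))
  where
  head : ∀ {ys} → All (x ≢_) ys → (∀ {z} → z ∈ ys → z ∈ xs) → All (g x ≢_) (map g ys)
  head [] _ = []
  head (ne ∷ nes) sub = (λ e → ne (inj (here refl) (there (sub (here refl))) e)) ∷ head nes (λ m → sub (there m))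

mem⇒nonempty : ∀ {A : Set} {x : A} {xs} → x ∈ xs → 1 ≤ length xs
mem⇒nonempty {xs = _ ∷ _} _ = s≤s z≤n

nonempty⇒∃∈ : ∀ {A : Set} {xs : List A} → 1 ≤ length xs → ∃ λ x → x ∈ xs
nonempty⇒∃∈ {xs = x ∷ _} _ = x , here refl

-- Counting the sites below a given site

sites-∈ : ∀ {u n} → u ∈ sites n → 1 ≤ u × u ≤ n
sites-∈ {n = suc n} (here refl) = s≤s z≤n , ≤-refl
sites-∈ {n = suc n} (there p) = let (a , b) = sites-∈ p in a , m≤n⇒m≤1+n b

∈-sites : ∀ {u n} → 1 ≤ u → u ≤ n → u ∈ sites n
∈-sites {u} {zero} p q = ⊥-elim (<⇒≱ p q)
∈-sites {u} {suc n} p q with u ≟ suc n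
... | yes refl = here refl
... | no ne = there (∈-sites p (≤-pred (≤∧≢⇒< q ne)))

countℕ≡∑ : ∀ p xs → countℕ p xs ≡ ∑ xs (λ x → χ (p x))
countℕ≡∑ p [] = refl
countℕ≡∑ p (x ∷ xs) = cong (χ (p x) +_) (countℕ≡∑ p xs)

countA≡∑ : ∀ p xs → countA p xs ≡ ∑ xs (λ x → χ (p x))
countA≡∑ p [] = refl
countA≡∑ p (x ∷ xs) = cong (χ (p x) +_) (countA≡∑ p xs)

∑-pick : ∀ n a (g : ℕ → ℕ) → 1 ≤ a → a ≤ n → ∑ (sites n) (λ u → g u * χ (a ≡ᵇ u)) ≡ g a
∑-pick zero a g p q = ⊥-elim (<⇒≱ p q)
∑-pick (suc n) a g p q with ≡ᵇ-view a (suc n)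
... | inj₁ (e , refl) rewrite e | *-identityʳ (g (suc n)) =
  trans (cong (g (suc n) +_) (∑-zero (sites n) _ others)) (+-identityʳ _)
  where
  others : ∀ u → u ∈ sites n → g u * χ (suc n ≡ᵇ u) ≡ 0
  others u m rewrite ≢⇒≡ᵇ-false {suc n} {u} (λ e' → <⇒≢ (s≤s (proj₂ (sites-∈ m))) (sym e')) = *-zeroʳ (g u)
... | inj₂ (e , ne) rewrite e | *-zeroʳ (g (suc n)) = ∑-pick n a g p (≤-pred (≤∧≢⇒< q ne))

#sites-below : ∀ n x → ∑ (sites n) (λ u → χ (u <ᵇ x)) ≡ (x ∸ 1) ⊓ n
#sites-below zero x = sym (m≥n⇒m⊓n≡n {x ∸ 1} z≤n)
#sites-below (suc n) x rewrite #sites-below n x with <ᵇ-view (suc n) x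
... | inj₁ (e , lt) rewrite e = trans (cong suc (m≥n⇒m⊓n≡n (≤-trans (n≤1+n n) n<x∸1))) (sym (m≥n⇒m⊓n≡n n<x∸1))
  where
  n<x∸1 : suc n ≤ x ∸ 1
  n<x∸1 = ≤-trans (≤-reflexive (sym (m+n∸n≡m (suc n) 1))) (∸-monoˡ-≤ 1 (≤-trans (≤-reflexive (+-comm (suc n) 1)) lt))
... | inj₂ (e , ge) rewrite e = trans (m≤n⇒m⊓n≡m (∸-monoˡ-≤ 1 ge)) (sym (m≤n⇒m⊓n≡m (≤-trans (∸-monoˡ-≤ 1 ge) (n≤1+n n))))

ArcsWithin : ℕ → List Arc → Set
ArcsWithin n S = ∀ α → α ∈ S → 1 ≤ proj₁ α × proj₁ α < proj₂ α × proj₂ α ≤ n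

Deg≤1 : List Arc → Set
Deg≤1 S = ∀ s → deg S s ≤ 1

arcDeg : ℕ → Arc → ℕ
arcDeg s (a , b) = χ (a ≡ᵇ s) + χ (b ≡ᵇ s)

deg≡∑arcDeg : ∀ S s → deg S s ≡ ∑ S (arcDeg s)
deg≡∑arcDeg [] s = refl
deg≡∑arcDeg ((a , b) ∷ S) s = cong (χ (a ≡ᵇ s) + χ (b ≡ᵇ s) +_) (deg≡∑arcDeg S s)

endsBelow : List Arc → ℕ → ℕ
endsBelow S x = ∑ S (λ β → χ (proj₁ β <ᵇ x) + χ (proj₂ β <ᵇ x))

free? : List Arc → ℕ → Bool
free? S u = deg S u ≡ᵇ 0

nFreeBelow≡∑ : ∀ n S x → nFreeBelow n S x ≡ ∑ (sites n) (λ u → χ (free? S u ∧ (u <ᵇ x)))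
nFreeBelow≡∑ n S x = countℕ≡∑ _ (sites n)

nFree≡∑ : ∀ n S → nFree n S ≡ ∑ (sites n) (λ u → χ (free? S u))
nFree≡∑ n S = countℕ≡∑ _ (sites n)

nFree≡nFreeBelow-suc : ∀ n S → nFree n S ≡ nFreeBelow n S (suc n)
nFree≡nFreeBelow-suc n S = begin
  nFree n S                                                ≡⟨ nFree≡∑ n S ⟩
  ∑ (sites n) (λ u → χ (free? S u))                        ≡⟨ ∑-cong (sites n) below ⟩
  ∑ (sites n) (λ u → χ (free? S u ∧ (u <ᵇ suc n)))         ≡⟨ nFreeBelow≡∑ n S (suc n) ⟨
  nFreeBelow n S (suc n)                                   ∎
  where
  open ≡-Reasoning
  below : ∀ u → u ∈ sites n → χ (free? S u) ≡ χ (free? S u ∧ (u <ᵇ suc n))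
  below u m rewrite <⇒<ᵇ-true (s≤s (proj₂ (sites-∈ m))) = cong χ (sym (BP.∧-identityʳ (free? S u)))

χ-split-by-degree : ∀ d b → d ≤ 1 → χ b ≡ χ ((d ≡ᵇ 0) ∧ b) + χ b * d
χ-split-by-degree zero b _ = sym (trans (cong (χ b +_) (*-zeroʳ (χ b))) (+-identityʳ _))
χ-split-by-degree (suc zero) b _ = sym (*-identityʳ (χ b))
χ-split-by-degree (suc (suc d)) b (s≤s ())

endsBelow≡∑deg : ∀ n S x → ArcsWithin n S → endsBelow S x ≡ ∑ (sites n) (λ u → χ (u <ᵇ x) * deg S u)
endsBelow≡∑deg n S x within = sym (begin
  ∑ (sites n) (λ u → χ (u <ᵇ x) * deg S u)
    ≡⟨ ∑-cong (sites n) (λ u _ → trans (cong (χ (u <ᵇ x) *_) (deg≡∑arcDeg S u)) (sym (∑-scale S (χ (u <ᵇ x)) (arcDeg u)))) ⟩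
  ∑ (sites n) (λ u → ∑ S (λ β → χ (u <ᵇ x) * arcDeg u β))
    ≡⟨ ∑-swap (sites n) S (λ u β → χ (u <ᵇ x) * arcDeg u β) ⟩
  ∑ S (λ β → ∑ (sites n) (λ u → χ (u <ᵇ x) * arcDeg u β))
    ≡⟨ ∑-cong S ends ⟩
  endsBelow S x ∎)
  where
  open ≡-Reasoning
  ends : ∀ β → β ∈ S → ∑ (sites n) (λ u → χ (u <ᵇ x) * arcDeg u β) ≡ χ (proj₁ β <ᵇ x) + χ (proj₂ β <ᵇ x)
  ends (a , b) m =
    let (1≤a , a<b , b≤n) = within (a , b) m in
    trans (∑-cong (sites n) (λ u _ → *-distribˡ-+ (χ (u <ᵇ x)) (χ (a ≡ᵇ u)) (χ (b ≡ᵇ u))))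
    (trans (∑-+ (sites n) _ _)
      (cong₂ _+_ (∑-pick n a (λ u → χ (u <ᵇ x)) 1≤a (≤-trans (<⇒≤ a<b) b≤n))
                 (∑-pick n b (λ u → χ (u <ᵇ x)) (≤-trans 1≤a (<⇒≤ a<b)) b≤n)))

-- Every site below x is either free or the endpoint of exactly one arc.
nFreeBelow+endsBelow : ∀ n S x → ArcsWithin n S → Deg≤1 S → nFreeBelow n S x + endsBelow S x ≡ (x ∸ 1) ⊓ n
nFreeBelow+endsBelow n S x within deg≤1 = begin
  nFreeBelow n S x + endsBelow S x
    ≡⟨ cong₂ _+_ (nFreeBelow≡∑ n S x) (endsBelow≡∑deg n S x within) ⟩
  ∑ (sites n) (λ u → χ (free? S u ∧ (u <ᵇ x))) + ∑ (sites n) (λ u → χ (u <ᵇ x) * deg S u)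
    ≡⟨ ∑-+ (sites n) _ _ ⟨
  ∑ (sites n) (λ u → χ (free? S u ∧ (u <ᵇ x)) + χ (u <ᵇ x) * deg S u)
    ≡⟨ ∑-cong (sites n) (λ u _ → sym (χ-split-by-degree (deg S u) (u <ᵇ x) (deg≤1 u))) ⟩
  ∑ (sites n) (λ u → χ (u <ᵇ x))
    ≡⟨ #sites-below n x ⟩
  (x ∸ 1) ⊓ n ∎
  where open ≡-Reasoning

endsBelow-all : ∀ n S → ArcsWithin n S → endsBelow S (suc n) ≡ 2 * length S
endsBelow-all n [] within = refl
endsBelow-all n ((a , b) ∷ S) within =
  let (1≤a , a<b , b≤n) = within (a , b) (here refl) in
  trans (cong₂ (λ p q → χ p + χ q + endsBelow S (suc n)) (<⇒<ᵇ-true (s≤s (≤-trans (<⇒≤ a<b) b≤n))) (<⇒<ᵇ-true (s≤s b≤n)))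
        (trans (cong (2 +_) (endsBelow-all n S (λ α m → within α (there m)))) (sym (*-suc 2 (length S))))

nFree+2*arcs≡length : ∀ n S → ArcsWithin n S → Deg≤1 S → nFree n S + 2 * length S ≡ n
nFree+2*arcs≡length n S within deg≤1 =
  trans (cong₂ _+_ (nFree≡nFreeBelow-suc n S) (sym (endsBelow-all n S within)))
        (trans (nFreeBelow+endsBelow n S (suc n) within deg≤1) (m≤n⇒m⊓n≡m ≤-refl))

<ₐ-irrefl : ∀ {x} → ¬ (x <ₐ x)
<ₐ-irrefl {a , b} (inj₁ lt) = <-irrefl refl lt
<ₐ-irrefl {a , b} (inj₂ (_ , lt)) = <-irrefl refl lt

<ₐ-trans : ∀ {x y z} → x <ₐ y → y <ₐ z → x <ₐ z
<ₐ-trans {a , b} {c , d} {e , f} (inj₁ p) (inj₁ q) = inj₁ (<-trans p q)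
<ₐ-trans {a , b} {c , d} {e , f} (inj₁ p) (inj₂ (refl , q)) = inj₁ p
<ₐ-trans {a , b} {c , d} {e , f} (inj₂ (refl , p)) (inj₁ q) = inj₁ q
<ₐ-trans {a , b} {c , d} {e , f} (inj₂ (refl , p)) (inj₂ (refl , q)) = inj₂ (refl , <-trans p q)

Sorted : List Arc → Set
Sorted = AllPairs _<ₐ_

Sorted⇒Unique : ∀ {xs} → Sorted xs → Unique xs
Sorted⇒Unique = AP.map (λ { lt refl → <ₐ-irrefl lt })

Linked⇒Sorted : ∀ {xs} → Linked _<ₐ_ xs → Sorted xs
Linked⇒Sorted = Linked⇒AllPairs <ₐ-trans

Sorted⇒Linked : ∀ {xs} → Sorted xs → Linked _<ₐ_ xs
Sorted⇒Linked = AllPairs⇒Linked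

module _ {A : Set} {_≺_ : A → A → Set} (≺-irrefl : ∀ {x} → ¬ (x ≺ x))
         (≺-trans : ∀ {x y z} → x ≺ y → y ≺ z → x ≺ z) where

  AllPairs-≺-extensional : ∀ xs ys → AllPairs _≺_ xs → AllPairs _≺_ ys →
                           (∀ {z} → z ∈ xs → z ∈ ys) → (∀ {z} → z ∈ ys → z ∈ xs) → xs ≡ ys
  AllPairs-≺-extensional [] [] _ _ _ _ = refl
  AllPairs-≺-extensional [] (y ∷ ys) _ _ _ ys⊆ with ys⊆ (here refl)
  ... | ()
  AllPairs-≺-extensional (x ∷ xs) [] _ _ xs⊆ _ with xs⊆ (here refl)
  ... | ()
  AllPairs-≺-extensional (x ∷ xs) (y ∷ ys) (x≺ ∷ sx) (y≺ ∷ sy) xs⊆ ys⊆ with xs⊆ (here refl) | ys⊆ (here refl)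
  ... | here refl | _ = cong (x ∷_) (AllPairs-≺-extensional xs ys sx sy
          (λ m → tail (xs⊆ (there m)) (λ { refl → ≺-irrefl (All.lookup x≺ m) }))
          (λ m → tail (ys⊆ (there m)) (λ { refl → ≺-irrefl (All.lookup y≺ m) })))
    where
    tail : ∀ {z w ws} → z ∈ w ∷ ws → z ≢ w → z ∈ ws
    tail (here e) ne = ⊥-elim (ne e)
    tail (there q) ne = q
  ... | there p | here refl = ⊥-elim (≺-irrefl (All.lookup y≺ p))
  ... | there p | there q = ⊥-elim (≺-irrefl (≺-trans (All.lookup y≺ p) (All.lookup x≺ q)))

Sorted-extensional : ∀ xs ys → Sorted xs → Sorted ys → (∀ {z} → z ∈ xs → z ∈ ys) → (∀ {z} → z ∈ ys → z ∈ xs) → xs ≡ ys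
Sorted-extensional = AllPairs-≺-extensional <ₐ-irrefl <ₐ-trans

_<ₐ?_ : ∀ x y → Dec (x <ₐ y)
x <ₐ? y = (proj₁ x <? proj₁ y) ⊎-dec ((proj₁ x ≟ proj₁ y) ×-dec (proj₂ x <? proj₂ y))

flip : Arc → Arc
flip (i , j) = (j , i)

flip-injective : ∀ {x y} → flip x ≡ flip y → x ≡ y
flip-injective {a , b} {c , d} q = cong₂ _,_ (cong proj₂ q) (cong proj₁ q)

⊆-or-counterexample : ∀ (L M : List Arc) → L ⊆ M ⊎ ∃ λ x → x ∈ L × ¬ x ∈ M
⊆-or-counterexample L M with all? (_∈? M) L
... | yes L⊆M = inj₁ (All.lookup L⊆M)
... | no L⊈M = inj₂ (find (¬All⇒Any¬ (_∈? M) L L⊈M))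

range : ℕ → ℕ → List ℕ
range a zero = []
range a (suc k) = a ∷ range (suc a) k

∈-range⁻ : ∀ {x} a k → x ∈ range a k → a ≤ x × x < a + k
∈-range⁻ a (suc k) (here refl) = ≤-refl , m<m+n a (s≤s z≤n)
∈-range⁻ {x} a (suc k) (there m) = let (p , q) = ∈-range⁻ (suc a) k m in <⇒≤ p , subst (x <_) (sym (+-suc a k)) q

∈-range⁺ : ∀ {x} a k → a ≤ x → x < a + k → x ∈ range a k
∈-range⁺ {x} a zero p q = ⊥-elim (<⇒≱ q (subst (_≤ x) (sym (+-identityʳ a)) p))
∈-range⁺ {x} a (suc k) p q with a ≟ x
... | yes refl = here refl
... | no ne = there (∈-range⁺ (suc a) k (≤∧≢⇒< p ne) (subst (x <_) (+-suc a k) q))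

range-increasing : ∀ a k → AllPairs _<_ (range a k)
range-increasing a zero = []
range-increasing a (suc k) = tabulate (λ m → proj₁ (∈-range⁻ (suc a) k m)) ∷ range-increasing (suc a) k

-- pairs m enumerates the arcs 1 ≤ i < j ≤ m in lexicographic order.
row : ℕ → ℕ → List Arc
row m i = map (i ,_) (range (suc i) (m ∸ i))

rowsFrom : ℕ → ℕ → ℕ → List Arc
rowsFrom m a zero = []
rowsFrom m a (suc k) = row m a ++ rowsFrom m (suc a) k

pairs : ℕ → List Arc
pairs m = rowsFrom m 1 m

∈-row⁻ : ∀ {i j} m a → (i , j) ∈ row m a → i ≡ a × a < j × j ≤ m
∈-row⁻ {i} {j} m a p with ∈-map⁻ (a ,_) p
... | (j' , q , refl) = let (a<j , j<) = ∈-range⁻ (suc a) (m ∸ a) q in refl , a<j , below-m a<j j<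
  where
  below-m : a < j → j < suc a + (m ∸ a) → j ≤ m
  below-m a<j j< with a ≤? m
  ... | yes a≤m = ≤-pred (subst (j <_) (cong suc (m+[n∸m]≡n a≤m)) j<)
  ... | no a≰m = ⊥-elim (<⇒≱ j< (subst (_≤ j) (sym (trans (cong (suc a +_) (m≤n⇒m∸n≡0 (<⇒≤ (≰⇒> a≰m)))) (+-identityʳ (suc a)))) a<j))

∈-row⁺ : ∀ {j} m a → a < j → j ≤ m → (a , j) ∈ row m a
∈-row⁺ {j} m a p q = ∈-map⁺ (a ,_) (∈-range⁺ (suc a) (m ∸ a) p
   (subst (j <_) (sym (cong suc (m+[n∸m]≡n (≤-trans (<⇒≤ p) q)))) (s≤s q)))

row-sorted : ∀ m a → Sorted (row m a)
row-sorted m a = APP.map⁺ (AP.map (λ lt → inj₂ (refl , lt)) (range-increasing (suc a) (m ∸ a)))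

∈-rowsFrom⁻ : ∀ {i j} m a k → (i , j) ∈ rowsFrom m a k → a ≤ i × i < j × j ≤ m
∈-rowsFrom⁻ m a (suc k) p with ∈-++⁻ (row m a) p
... | inj₁ q = let (e , u , v) = ∈-row⁻ m a q in ≤-reflexive (sym e) , subst (_< _) (sym e) u , v
... | inj₂ q = let (e , u , v) = ∈-rowsFrom⁻ m (suc a) k q in <⇒≤ e , u , v

∈-rowsFrom⁺ : ∀ {i j} m a k → a ≤ i → i < a + k → i < j → j ≤ m → (i , j) ∈ rowsFrom m a k
∈-rowsFrom⁺ {i} m a zero p q _ _ = ⊥-elim (<⇒≱ q (subst (_≤ i) (sym (+-identityʳ a)) p))
∈-rowsFrom⁺ {i} m a (suc k) p q u v with a ≟ i
... | yes refl = ∈-++⁺ˡ (∈-row⁺ m a u v)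
... | no ne = ∈-++⁺ʳ (row m a) (∈-rowsFrom⁺ m (suc a) k (≤∧≢⇒< p ne) (subst (i <_) (+-suc a k) q) u v)

rowsFrom-sorted : ∀ m a k → Sorted (rowsFrom m a k)
rowsFrom-sorted m a zero = []
rowsFrom-sorted m a (suc k) = APP.++⁺ (row-sorted m a) (rowsFrom-sorted m (suc a) k)
  (tabulate (λ {x} mx → tabulate (λ {y} my → row<rest x y mx my)))
  where
  row<rest : ∀ x y → x ∈ row m a → y ∈ rowsFrom m (suc a) k → x <ₐ y
  row<rest (i , j) (i' , j') mx my with ∈-row⁻ m a mx | ∈-rowsFrom⁻ m (suc a) k my
  ... | (refl , _) | (le , _) = inj₁ le

∈-pairs⁻ : ∀ {i j} m → (i , j) ∈ pairs m → 1 ≤ i × i < j × j ≤ m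
∈-pairs⁻ m p = ∈-rowsFrom⁻ m 1 m p

∈-pairs⁺ : ∀ {i j} m → 1 ≤ i → i < j → j ≤ m → (i , j) ∈ pairs m
∈-pairs⁺ m p u v = ∈-rowsFrom⁺ m 1 m p (s≤s (≤-trans (<⇒≤ u) v)) u v

pairs-sorted : ∀ m → Sorted (pairs m)
pairs-sorted m = rowsFrom-sorted m 1 m

Supports⇒1≤arcDeg : ∀ {s} α → Supports s α → 1 ≤ arcDeg s α
Supports⇒1≤arcDeg {s} (a , b) (inj₁ refl) rewrite ≡ᵇ-refl s = s≤s z≤n
Supports⇒1≤arcDeg {s} (a , b) (inj₂ refl) rewrite ≡ᵇ-refl s = m≤n+m 1 (χ (a ≡ᵇ s))

¬Supports⇒arcDeg≡0 : ∀ s α → ¬ Supports s α → arcDeg s α ≡ 0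
¬Supports⇒arcDeg≡0 s (a , b) ns with ≡ᵇ-view a s | ≡ᵇ-view b s
... | inj₁ (_ , e) | _ = ⊥-elim (ns (inj₁ (sym e)))
... | inj₂ _ | inj₁ (_ , e) = ⊥-elim (ns (inj₂ (sym e)))
... | inj₂ (e1 , _) | inj₂ (e2 , _) rewrite e1 | e2 = refl

Supports⇒1≤deg : ∀ {S s α} → α ∈ S → Supports s α → 1 ≤ deg S s
Supports⇒1≤deg {S} {s} {α} m p =
  subst (1 ≤_) (sym (deg≡∑arcDeg S s)) (≤-trans (Supports⇒1≤arcDeg α p) (term≤∑ S (arcDeg s) m))

deg≡0⇒¬Supports : ∀ {S s α} → deg S s ≡ 0 → α ∈ S → ¬ Supports s α
deg≡0⇒¬Supports e m p = <⇒≱ (Supports⇒1≤deg m p) (≤-reflexive e)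

supporting-arc-unique : ∀ {S s α β} → Deg≤1 S → α ∈ S → β ∈ S → Supports s α → Supports s β → α ≡ β
supporting-arc-unique {S} {s} {α} {β} deg≤1 mα mβ pα pβ with ≡-dec _≟_ _≟_ α β
... | yes e = e
... | no ne = ⊥-elim (<⇒≱ (subst (2 ≤_) (sym (deg≡∑arcDeg S s))
                              (two-terms≤∑ S (arcDeg s) mα mβ ne (Supports⇒1≤arcDeg α pα) (Supports⇒1≤arcDeg β pβ)))
                       (deg≤1 s))

arcDeg≤1 : ∀ u {c d} → c < d → arcDeg u (c , d) ≤ 1
arcDeg≤1 u {c} {d} c<d with ≡ᵇ-view c u
... | inj₂ (e , _) rewrite e = χ≤1 (d ≡ᵇ u)
... | inj₁ (e , refl) rewrite e | ≢⇒≡ᵇ-false {d} {c} (λ q → <-irrefl (sym q) c<d) = ≤-refl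

1≤arcDeg⇒Supports : ∀ {u c d} → 1 ≤ arcDeg u (c , d) → Supports u (c , d)
1≤arcDeg⇒Supports {u} {c} {d} p with ≡ᵇ-view c u | ≡ᵇ-view d u
... | inj₁ (_ , e) | _ = inj₁ (sym e)
... | inj₂ _ | inj₁ (_ , e) = inj₂ (sym e)
... | inj₂ (e₁ , _) | inj₂ (e₂ , _) rewrite e₁ | e₂ = ⊥-elim (<⇒≱ p z≤n)

Cross⇒supports-disjoint : ∀ {α β x y} → Cross α β → Supports x α → Supports y β → x ≢ y
Cross⇒supports-disjoint (inj₁ (p , q , r)) (inj₁ refl) (inj₁ refl) refl = <-irrefl refl p
Cross⇒supports-disjoint (inj₁ (p , q , r)) (inj₁ refl) (inj₂ refl) refl = <-irrefl refl (<-trans p (<-trans q r))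
Cross⇒supports-disjoint (inj₁ (p , q , r)) (inj₂ refl) (inj₁ refl) refl = <-irrefl refl q
Cross⇒supports-disjoint (inj₁ (p , q , r)) (inj₂ refl) (inj₂ refl) refl = <-irrefl refl r
Cross⇒supports-disjoint (inj₂ (p , q , r)) (inj₁ refl) (inj₁ refl) refl = <-irrefl refl p
Cross⇒supports-disjoint (inj₂ (p , q , r)) (inj₁ refl) (inj₂ refl) refl = <-irrefl refl q
Cross⇒supports-disjoint (inj₂ (p , q , r)) (inj₂ refl) (inj₁ refl) refl = <-irrefl refl (<-trans p (<-trans q r))
Cross⇒supports-disjoint (inj₂ (p , q , r)) (inj₂ refl) (inj₂ refl) refl = <-irrefl refl r

private
  nFreeBelow-term-mono : ∀ S u {x y} → x ≤ y → χ (free? S u ∧ (u <ᵇ x)) ≤ χ (free? S u ∧ (u <ᵇ y))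
  nFreeBelow-term-mono S u {x} {y} le with free? S u
  ... | false = z≤n
  ... | true with <ᵇ-view u x
  ...   | inj₁ (e , lt) rewrite e | <⇒<ᵇ-true (<-≤-trans lt le) = ≤-refl
  ...   | inj₂ (e , _) rewrite e = z≤n

nFreeBelow-mono : ∀ n S {x y} → x ≤ y → nFreeBelow n S x ≤ nFreeBelow n S y
nFreeBelow-mono n S {x} {y} le = subst₂ _≤_ (sym (nFreeBelow≡∑ n S x)) (sym (nFreeBelow≡∑ n S y))
                                   (∑-mono (sites n) (λ u _ → nFreeBelow-term-mono S u le))

block-mono : ∀ n S {x y} → x ≤ y → block n S x ≤ block n S y
block-mono n S le = s≤s (nFreeBelow-mono n S le)

block-<⇒< : ∀ n S {x y} → block n S x < block n S y → x < y
block-<⇒< n S {x} {y} lt with <-cmp x y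
... | tri< p _ _ = p
... | tri≈ _ refl _ = ⊥-elim (<-irrefl refl lt)
... | tri> _ _ p = ⊥-elim (<⇒≱ lt (block-mono n S (<⇒≤ p)))

nFreeBelow-<⇒free-between : ∀ n S {x y} → nFreeBelow n S x < nFreeBelow n S y → ∃ λ u → Free n S u × x ≤ u × u < y
nFreeBelow-<⇒free-between n S {x} {y} lt with ∑-<⇒ (sites n) _ _ (subst₂ _<_ (nFreeBelow≡∑ n S x) (nFreeBelow≡∑ n S y) lt)
... | (u , m , q) with free? S u in isFree
...   | false = ⊥-elim (<⇒≱ q z≤n)
...   | true with <ᵇ-view u x | <ᵇ-view u y
...     | _ | inj₂ (e2 , _) rewrite e2 = ⊥-elim (<⇒≱ q z≤n)
...     | inj₁ (e1 , _) | inj₁ (e2 , _) rewrite e1 | e2 = ⊥-elim (<-irrefl refl q)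
...     | inj₂ (_ , x≤u) | inj₁ (_ , u<y) = u , (proj₁ (sites-∈ m) , proj₂ (sites-∈ m) , ≡ᵇ-true⇒≡ isFree) , x≤u , u<y

nFreeBelow-<⇒covered : ∀ n S {c d} → (c , d) ∈ S → nFreeBelow n S c < nFreeBelow n S d →
                       ∃ λ s → Free n S s × Covered s (c , d)
nFreeBelow-<⇒covered n S {c} {d} m lt with nFreeBelow-<⇒free-between n S lt
... | (u , F , c≤u , u<d) with m≤n⇒m<n∨m≡n c≤u
...   | inj₁ c<u = u , F , c<u , u<d
...   | inj₂ refl = ⊥-elim (deg≡0⇒¬Supports (proj₂ (proj₂ F)) m (inj₁ refl))

free-between⇒nFreeBelow-< : ∀ n S {x y u} → Free n S u → x ≤ u → u < y → nFreeBelow n S x < nFreeBelow n S y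
free-between⇒nFreeBelow-< n S {x} {y} {u} (1≤u , u≤n , free) x≤u u<y =
  subst₂ _<_ (sym (nFreeBelow≡∑ n S x)) (sym (nFreeBelow≡∑ n S y))
    (∑-< (sites n) _ _ (λ v _ → nFreeBelow-term-mono S v (≤-trans x≤u (<⇒≤ u<y))) (∈-sites 1≤u u≤n) u-counts)
  where
  u-counts : χ (free? S u ∧ (u <ᵇ x)) < χ (free? S u ∧ (u <ᵇ y))
  u-counts rewrite ≡⇒≡ᵇ-true free | ≥⇒<ᵇ-false x≤u | <⇒<ᵇ-true u<y = s≤s z≤n

nFreeBelow≤nFree : ∀ n S x → nFreeBelow n S x ≤ nFree n S
nFreeBelow≤nFree n S x with x ≤? suc n
... | yes le = subst (nFreeBelow n S x ≤_) (sym (nFree≡nFreeBelow-suc n S)) (nFreeBelow-mono n S le)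
... | no nle = ≤-reflexive (trans (sym all-sites) (sym (nFree≡nFreeBelow-suc n S)))
  where
  all-sites : nFreeBelow n S (suc n) ≡ nFreeBelow n S x
  all-sites = trans (nFreeBelow≡∑ n S (suc n)) (trans (∑-cong (sites n) below) (sym (nFreeBelow≡∑ n S x)))
    where
    below : ∀ u → u ∈ sites n → χ (free? S u ∧ (u <ᵇ suc n)) ≡ χ (free? S u ∧ (u <ᵇ x))
    below u m = cong (λ z → χ (free? S u ∧ z))
      (trans (<⇒<ᵇ-true (s≤s (proj₂ (sites-∈ m)))) (sym (<⇒<ᵇ-true (<-trans (s≤s (proj₂ (sites-∈ m))) (≰⇒> nle)))))

free-above⇒nFreeBelow<nFree : ∀ n S {x u} → Free n S u → x ≤ u → nFreeBelow n S x < nFree n S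
free-above⇒nFreeBelow<nFree n S {x} F@(_ , u≤n , _) x≤u =
  subst (nFreeBelow n S x <_) (sym (nFree≡nFreeBelow-suc n S)) (free-between⇒nFreeBelow-< n S F x≤u (s≤s u≤n))

nFreeBelow-zero : ∀ n S → nFreeBelow n S 0 ≡ 0
nFreeBelow-zero n S = trans (nFreeBelow≡∑ n S 0) (∑-zero (sites n) _ none)
  where
  none : ∀ u → u ∈ sites n → χ (free? S u ∧ (u <ᵇ 0)) ≡ 0
  none u _ rewrite ≥⇒<ᵇ-false {u} {0} z≤n = cong χ (BP.∧-zeroʳ (free? S u))

block≢1⇒free-below : ∀ n S {x} → block n S x ≢ 1 → ∃ λ u → Free n S u × u < x
block≢1⇒free-below n S {x} ≢1 with nFreeBelow-<⇒free-between n S {0} {x} (subst (_< nFreeBelow n S x) (sym (nFreeBelow-zero n S)) pos)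
  where
  pos : 0 < nFreeBelow n S x
  pos with nFreeBelow n S x
  ... | zero = ⊥-elim (≢1 refl)
  ... | suc _ = s≤s z≤n
... | (u , F , _ , u<x) = u , F , u<x

block≢last⇒free-above : ∀ n S {x} → block n S x ≢ suc (nFree n S) → ∃ λ u → Free n S u × x ≤ u
block≢last⇒free-above n S {x} ≢last
  with nFreeBelow-<⇒free-between n S {x} {suc n}
         (subst (nFreeBelow n S x <_) (nFree≡nFreeBelow-suc n S) (≤∧≢⇒< (nFreeBelow≤nFree n S x) (λ e → ≢last (cong suc e))))
... | (u , F , x≤u , _) = u , F , x≤u

joins : ℕ → List Arc → ℕ → ℕ → Arc → Bool
joins n S i j (a , b) = ((block n S a ≡ᵇ i) ∧ (block n S b ≡ᵇ j)) ∨ ((block n S a ≡ᵇ j) ∧ (block n S b ≡ᵇ i))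

blockMatrix≡∑ : ∀ n S i j → blockMatrix n S i j ≡ ∑ S (λ α → χ (joins n S i j α))
blockMatrix≡∑ n S i j = countA≡∑ _ S

blockMatrix-sym : ∀ n S i j → blockMatrix n S i j ≡ blockMatrix n S j i
blockMatrix-sym n S i j = trans (blockMatrix≡∑ n S i j) (trans (∑-cong S swap-joins) (sym (blockMatrix≡∑ n S j i)))
  where
  swap-joins : ∀ α → α ∈ S → χ (joins n S i j α) ≡ χ (joins n S j i α)
  swap-joins (a , b) _ = cong χ (BP.∨-comm ((block n S a ≡ᵇ i) ∧ (block n S b ≡ᵇ j)) ((block n S a ≡ᵇ j) ∧ (block n S b ≡ᵇ i)))

joins-own-blocks : ∀ n S a b → joins n S (block n S a) (block n S b) (a , b) ≡ true
joins-own-blocks n S a b rewrite ≡ᵇ-refl (block n S a) | ≡ᵇ-refl (block n S b) = refl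

arc⇒1≤blockMatrix : ∀ n S {a b} → (a , b) ∈ S → 1 ≤ blockMatrix n S (block n S a) (block n S b)
arc⇒1≤blockMatrix n S {a} {b} m = subst (1 ≤_) (sym (blockMatrix≡∑ n S (block n S a) (block n S b)))
  (≤-trans (≤-reflexive (cong χ (sym (joins-own-blocks n S a b)))) (term≤∑ S (λ α → χ (joins n S (block n S a) (block n S b) α)) m))

1≤blockMatrix⇒arc : ∀ n S i j → 1 ≤ blockMatrix n S i j → ∃ λ a → ∃ λ b → (a , b) ∈ S ×
  ((block n S a ≡ i × block n S b ≡ j) ⊎ (block n S a ≡ j × block n S b ≡ i))
1≤blockMatrix⇒arc n S i j p with ∑-pos⇒ S _ (subst (1 ≤_) (blockMatrix≡∑ n S i j) p)
... | ((a , b) , m , q) with ∨-∧-true⇒ (block n S a ≡ᵇ i) (block n S b ≡ᵇ j) (block n S a ≡ᵇ j) (block n S b ≡ᵇ i) (χ-pos⇒true q)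
... | inj₁ (e1 , e2) = a , b , m , inj₁ (≡ᵇ-true⇒≡ e1 , ≡ᵇ-true⇒≡ e2)
... | inj₂ (e1 , e2) = a , b , m , inj₂ (≡ᵇ-true⇒≡ e1 , ≡ᵇ-true⇒≡ e2)

tautologyOf : ℕ → (ℕ → ℕ → ℕ) → ℕ
tautologyOf f B = sumTo (suc f) (λ j → sumTo (j ∸ 1) (λ i → B i j ∸ 1)) + sumTo f (λ i → B i (suc i))

<⇒≤∸1 : ∀ {i j} → i < j → i ≤ j ∸ 1
<⇒≤∸1 {j = suc j} (s≤s i≤j) = i≤j

≤∸1⇒< : ∀ {i} j → 1 ≤ i → i ≤ j ∸ 1 → i < j
≤∸1⇒< zero 1≤i i≤0 = ⊥-elim (<⇒≱ 1≤i i≤0)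
≤∸1⇒< (suc j) _ i≤j = s≤s i≤j

sumTo≡0⇒ : ∀ m g → sumTo m g ≡ 0 → ∀ {i} → 1 ≤ i → i ≤ m → g i ≡ 0
sumTo≡0⇒ zero g e p q = ⊥-elim (<⇒≱ p q)
sumTo≡0⇒ (suc m) g e {i} p q with i ≟ suc m
... | yes refl = m+n≡0⇒n≡0 (sumTo m g) e
... | no ne = sumTo≡0⇒ m g (m+n≡0⇒m≡0 (sumTo m g) e) p (≤-pred (≤∧≢⇒< q ne))

sumTo≡0⇐ : ∀ m (g : ℕ → ℕ) → (∀ {i} → 1 ≤ i → i ≤ m → g i ≡ 0) → sumTo m g ≡ 0
sumTo≡0⇐ zero g h = refl
sumTo≡0⇐ (suc m) g h = cong₂ _+_ (sumTo≡0⇐ m g (λ p q → h p (≤-trans q (n≤1+n m)))) (h (s≤s z≤n) ≤-refl)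

sumTo-mono : ∀ m {g h : ℕ → ℕ} → (∀ i → g i ≤ h i) → sumTo m g ≤ sumTo m h
sumTo-mono zero le = z≤n
sumTo-mono (suc m) le = +-mono-≤ (sumTo-mono m le) (le (suc m))

tautologyOf-mono : ∀ f {B B' : ℕ → ℕ → ℕ} → (∀ i j → B' i j ≤ B i j) → tautologyOf f B' ≤ tautologyOf f B
tautologyOf-mono f le = +-mono-≤ (sumTo-mono (suc f) (λ j → sumTo-mono (j ∸ 1) (λ i → ∸-monoˡ-≤ 1 (le i j))))
                                 (sumTo-mono f (λ i → le i (suc i)))

tautologyOf≡0⇒entries≤1 : ∀ f B → tautologyOf f B ≡ 0 → ∀ {i j} → 1 ≤ i → i < j → j ≤ suc f → B i j ≤ 1
tautologyOf≡0⇒entries≤1 f B t {i} {j} 1≤i i<j j≤ =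
  m∸n≡0⇒m≤n (sumTo≡0⇒ (j ∸ 1) _ (sumTo≡0⇒ (suc f) _ (m+n≡0⇒m≡0 _ t) (≤-trans 1≤i (<⇒≤ i<j)) j≤) 1≤i (<⇒≤∸1 i<j))

tautologyOf≡0⇒adjacent≡0 : ∀ f B → tautologyOf f B ≡ 0 → ∀ {i} → 1 ≤ i → i ≤ f → B i (suc i) ≡ 0
tautologyOf≡0⇒adjacent≡0 f B t = sumTo≡0⇒ f _ (m+n≡0⇒n≡0 (sumTo (suc f) (λ j → sumTo (j ∸ 1) (λ i → B i j ∸ 1))) t)

tautologyOf≡0⇐ : ∀ f B → (∀ {i j} → 1 ≤ i → i < j → B i j ≤ 1) → (∀ i → B i (suc i) ≡ 0) → tautologyOf f B ≡ 0
tautologyOf≡0⇐ f B ≤1 adj≡0 =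
  cong₂ _+_ (sumTo≡0⇐ (suc f) _ (λ {j} _ _ → sumTo≡0⇐ (j ∸ 1) _ (λ 1≤i i≤ → m≤n⇒m∸n≡0 (≤1 1≤i (≤∸1⇒< j 1≤i i≤)))))
            (sumTo≡0⇐ f _ (λ {i} _ _ → adj≡0 i))

record P0Shape (f n : ℕ) (S : List Arc) : Set where
  field
    within : ArcsWithin n S
    sorted : Sorted S
    deg≤1 : Deg≤1 S
    nFree≡f : nFree n S ≡ f
    blocks-< : ∀ {a b} → (a , b) ∈ S → block n S a < block n S b
    block≤suc-f : ∀ {a b} → (a , b) ∈ S → block n S b ≤ suc f
    blocks-apart : ∀ {a b} → (a , b) ∈ S → suc (block n S a) < block n S b
    ¬first-to-last : ∀ {a b} → (a , b) ∈ S → block n S a ≡ 1 → block n S b ≢ suc f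
    blockMatrix≤1 : ∀ {i j} → 1 ≤ i → i < j → j ≤ suc f → blockMatrix n S i j ≤ 1

ValidArcs⇒ArcsWithin : ∀ {n S} → All (ValidArc n) S → ArcsWithin n S
ValidArcs⇒ArcsWithin valid α m = let (p , q , r , _) = All.lookup valid m in p , q , r

covered⇒blocks-< : ∀ n S {a b} → ∃ (λ s → Free n S s × Covered s (a , b)) → block n S a < block n S b
covered⇒blocks-< n S (u , F , a<u , u<b) = s≤s (free-between⇒nFreeBelow-< n S F (<⇒≤ a<u) u<b)

first-to-last⇒covers-all : ∀ n S {a b} → (a , b) ∈ S → block n S a ≡ 1 → block n S b ≡ suc (nFree n S) →
                           ∀ s → Free n S s → Covered s (a , b)
first-to-last⇒covers-all n S {a} {b} m first last s F@(_ , _ , free) with <-cmp s a | <-cmp s b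
... | tri< s<a _ _ | _ = ⊥-elim (<⇒≱ (free-between⇒nFreeBelow-< n S F z≤n s<a)
                                     (≤-reflexive (trans (suc-injective first) (sym (nFreeBelow-zero n S)))))
... | tri≈ _ refl _ | _ = ⊥-elim (deg≡0⇒¬Supports free m (inj₁ refl))
... | tri> _ _ a<s | tri< s<b _ _ = a<s , s<b
... | tri> _ _ _ | tri≈ _ refl _ = ⊥-elim (deg≡0⇒¬Supports free m (inj₂ refl))
... | tri> _ _ _ | tri> _ _ b<s = ⊥-elim (<-irrefl (suc-injective last) (free-above⇒nFreeBelow<nFree n S F (<⇒≤ b<s)))

P0⇒P0Shape : ∀ {f k n S} → P0 f k n S → P0Shape f n S
P0⇒P0Shape {f} {k} {n} {S} ((valid , linked) , ((_ , deg≤1) , covers , ¬covers-all) , _ , nFree≡f , taut≡0) = record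
  { within = ValidArcs⇒ArcsWithin valid
  ; sorted = Linked⇒Sorted linked
  ; deg≤1 = deg≤1
  ; nFree≡f = nFree≡f
  ; blocks-< = blocks-<
  ; block≤suc-f = block≤suc-f
  ; blocks-apart = blocks-apart
  ; ¬first-to-last = λ m first last → ¬covers-all _ m (first-to-last⇒covers-all n S m first (trans last (cong suc (sym nFree≡f))))
  ; blockMatrix≤1 = tautologyOf≡0⇒entries≤1 f (blockMatrix n S) taut≡f
  }
  where
  taut≡f : tautologyOf f (blockMatrix n S) ≡ 0
  taut≡f = subst (λ g → tautologyOf g (blockMatrix n S) ≡ 0) nFree≡f taut≡0
  blocks-< : ∀ {a b} → (a , b) ∈ S → block n S a < block n S b
  blocks-< m = covered⇒blocks-< n S (covers _ m)
  block≤suc-f : ∀ {a b} → (a , b) ∈ S → block n S b ≤ suc f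
  block≤suc-f {b = b} m = s≤s (subst (nFreeBelow n S b ≤_) nFree≡f (nFreeBelow≤nFree n S b))
  blocks-apart : ∀ {a b} → (a , b) ∈ S → suc (block n S a) < block n S b
  blocks-apart {a} {b} m with suc (block n S a) ≟ block n S b
  ... | no ne = ≤∧≢⇒< (blocks-< m) ne
  ... | yes e = ⊥-elim (<⇒≱ (arc⇒1≤blockMatrix n S m) (≤-reflexive
                  (subst (λ z → blockMatrix n S (block n S a) z ≡ 0) e
                    (tautologyOf≡0⇒adjacent≡0 f (blockMatrix n S) taut≡f (s≤s z≤n)
                       (≤-pred (subst (_≤ suc f) (sym e) (block≤suc-f m)))))))

any≡true⇒ : ∀ {A : Set} (p : A → Bool) xs → any p xs ≡ true → ∃ λ x → x ∈ xs × p x ≡ true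
any≡true⇒ p (x ∷ xs) h with p x in eq
... | true = x , here refl , eq
... | false = let (y , m , py) = any≡true⇒ p xs h in y , there m , py

∈⇒any≡true : ∀ {A : Set} (p : A → Bool) {xs x} → x ∈ xs → p x ≡ true → any p xs ≡ true
∈⇒any≡true p (here refl) px rewrite px = refl
∈⇒any≡true p {y ∷ xs} (there m) px rewrite ∈⇒any≡true p m px = BP.∨-zeroʳ (p y)

Increasing : List Arc → Set
Increasing T = ∀ {e} → e ∈ T → proj₁ e < proj₂ e

ValidArcs⇒Increasing : ∀ {m T} → All (ValidArc m) T → Increasing T
ValidArcs⇒Increasing valid m = proj₁ (proj₂ (All.lookup valid m))

adjacent : ℕ → ℕ → Arc → Bool
adjacent i j (c , d) = ((c ≡ᵇ i) ∧ (d ≡ᵇ j)) ∨ ((c ≡ᵇ j) ∧ (d ≡ᵇ i))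

adjacent⇒ : ∀ {i j c d} → adjacent i j (c , d) ≡ true → (c ≡ i × d ≡ j) ⊎ (c ≡ j × d ≡ i)
adjacent⇒ {i} {j} {c} {d} h with ∨-∧-true⇒ (c ≡ᵇ i) (d ≡ᵇ j) (c ≡ᵇ j) (d ≡ᵇ i) h
... | inj₁ (e1 , e2) = inj₁ (≡ᵇ-true⇒≡ e1 , ≡ᵇ-true⇒≡ e2)
... | inj₂ (e1 , e2) = inj₂ (≡ᵇ-true⇒≡ e1 , ≡ᵇ-true⇒≡ e2)

adjacent-self : ∀ i j → adjacent i j (i , j) ≡ true
adjacent-self i j rewrite ≡ᵇ-refl i | ≡ᵇ-refl j = refl

adjacent-sym : ∀ i j e → adjacent i j e ≡ adjacent j i e
adjacent-sym i j (c , d) = BP.∨-comm ((c ≡ᵇ i) ∧ (d ≡ᵇ j)) ((c ≡ᵇ j) ∧ (d ≡ᵇ i))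

adjacent∈⇒ : ∀ {T i j} → Increasing T → i < j → ∀ {e} → e ∈ T → adjacent i j e ≡ true → e ≡ (i , j)
adjacent∈⇒ {T} {i} {j} inc i<j {c , d} m h with adjacent⇒ {i} {j} {c} {d} h
... | inj₁ (refl , refl) = refl
... | inj₂ (refl , refl) = ⊥-elim (<-asym i<j (inc m))

∈⇒adjMatrix≡1 : ∀ {T i j} → (i , j) ∈ T → adjMatrix T i j ≡ 1
∈⇒adjMatrix≡1 {T} {i} {j} m = cong χ (∈⇒any≡true (adjacent i j) m (adjacent-self i j))

1≤adjMatrix⇒∈ : ∀ {T i j} → Increasing T → i < j → 1 ≤ adjMatrix T i j → (i , j) ∈ T
1≤adjMatrix⇒∈ {T} {i} {j} inc i<j p with any≡true⇒ (adjacent i j) T (χ-pos⇒true p)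
... | (e , m , h) = subst (_∈ T) (adjacent∈⇒ inc i<j m h) m

adjMatrix≤1 : ∀ T i j → adjMatrix T i j ≤ 1
adjMatrix≤1 T i j = χ≤1 _

adjMatrix-diagonal : ∀ {T} → Increasing T → ∀ i → adjMatrix T i i ≡ 0
adjMatrix-diagonal {T} inc i = cong χ no-loop
  where
  no-loop : any (adjacent i i) T ≡ false
  no-loop with any (adjacent i i) T in eq
  ... | false = refl
  ... | true with any≡true⇒ (adjacent i i) T eq
  ...   | ((c , d) , m , h) with adjacent⇒ {i} {i} {c} {d} h
  ...     | inj₁ (refl , refl) = ⊥-elim (<-irrefl refl (inc m))
  ...     | inj₂ (refl , refl) = ⊥-elim (<-irrefl refl (inc m))

adjMatrix-sym : ∀ T i j → adjMatrix T i j ≡ adjMatrix T j i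
adjMatrix-sym T i j = cong χ (any-sym T)
  where
  any-sym : ∀ T → any (adjacent i j) T ≡ any (adjacent j i) T
  any-sym [] = refl
  any-sym (e ∷ T) = cong₂ _∨_ (adjacent-sym i j e) (any-sym T)

≤1-≡ : ∀ {x y} → x ≤ 1 → y ≤ 1 → (1 ≤ x → 1 ≤ y) → (1 ≤ y → 1 ≤ x) → x ≡ y
≤1-≡ {zero} {zero} _ _ _ _ = refl
≤1-≡ {zero} {suc _} _ _ _ y⇒x = ⊥-elim (<⇒≱ (y⇒x (s≤s z≤n)) z≤n)
≤1-≡ {suc _} {zero} _ _ x⇒y _ = ⊥-elim (<⇒≱ (x⇒y (s≤s z≤n)) z≤n)
≤1-≡ {suc zero} {suc zero} _ _ _ _ = refl
≤1-≡ {suc (suc _)} (s≤s ()) _ _ _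
≤1-≡ {suc zero} {suc (suc _)} _ (s≤s ()) _ _

KNoncrossing-reflect : ∀ {k S S'} (Over : Arc → Arc → Set) →
  (∀ {β'} → β' ∈ S' → ∃ λ β → β ∈ S × Over β β') →
  (∀ {β γ β' γ'} → Over β β' → Over γ γ' → Cross β' γ' → Cross β γ) →
  KNoncrossing k S → KNoncrossing k S'
KNoncrossing-reflect {k} {S} {S'} Over lift cross-reflects kS L' L'⊆S' crossing' =
  subst (_≤ k) (lifted-length lifts) (kS (lifted lifts) (lifted-∈ lifts) (lifted-crossing lifts crossing'))
  where
  Lift : Arc → Set
  Lift β' = ∃ λ β → β ∈ S × Over β β'
  lifts = All.map lift L'⊆S'
  lifted : ∀ {L} → All Lift L → List Arc
  lifted [] = []
  lifted ((β , _) ∷ qs) = β ∷ lifted qs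
  lifted-∈ : ∀ {L} (qs : All Lift L) → All (_∈ S) (lifted qs)
  lifted-∈ [] = []
  lifted-∈ ((_ , m , _) ∷ qs) = m ∷ lifted-∈ qs
  lifted-length : ∀ {L} (qs : All Lift L) → length (lifted qs) ≡ length L
  lifted-length [] = refl
  lifted-length (_ ∷ qs) = cong suc (lifted-length qs)
  crosses-lifted : ∀ {e L} (q : Lift e) (qs : All Lift L) → All (Cross e) L → All (Cross (proj₁ q)) (lifted qs)
  crosses-lifted q [] [] = []
  crosses-lifted q (r ∷ qs) (c ∷ cs) = cross-reflects (proj₂ (proj₂ q)) (proj₂ (proj₂ r)) c ∷ crosses-lifted q qs cs
  lifted-crossing : ∀ {L} (qs : All Lift L) → AllPairs Cross L → AllPairs Cross (lifted qs)
  lifted-crossing [] [] = []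
  lifted-crossing (r ∷ qs) (c ∷ cs) = crosses-lifted r qs c ∷ lifted-crossing qs cs

-- Suppressing an arc

-- Relabelling after deleting the two sites a < b: shift a b is strictly monotone on the sites
-- avoiding a and b, with inverse unshift a b.

skip : ℕ → ℕ → ℕ
skip c t = if t <ᵇ c then t else suc t

unshift : ℕ → ℕ → ℕ → ℕ
unshift a b t = skip a (skip (b ∸ 1) t)

Avoids : ℕ → ℕ → ℕ → Set
Avoids a b s = s ≢ a × s ≢ b

skip-below : ∀ {c t} → t < c → skip c t ≡ t
skip-below {c} {t} lt rewrite <⇒<ᵇ-true {t} {c} lt = refl

skip-above : ∀ {c t} → c ≤ t → skip c t ≡ suc t
skip-above {c} {t} le rewrite ≥⇒<ᵇ-false {t} {c} le = refl

skip-strictMono : ∀ c {t t'} → t < t' → skip c t < skip c t'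
skip-strictMono c {t} {t'} lt with <ᵇ-view t c | <ᵇ-view t' c
... | inj₁ (e , _) | inj₁ (e' , _) rewrite e | e' = lt
... | inj₁ (e , _) | inj₂ (e' , _) rewrite e | e' = <-trans lt (n<1+n t')
... | inj₂ (_ , c≤t) | inj₁ (_ , t'<c) = ⊥-elim (<⇒≱ (<-trans lt t'<c) c≤t)
... | inj₂ (e , _) | inj₂ (e' , _) rewrite e | e' = s≤s lt

unshift-strictMono : ∀ a b {t t'} → t < t' → unshift a b t < unshift a b t'
unshift-strictMono a b lt = skip-strictMono a (skip-strictMono (b ∸ 1) lt)

shift-below : ∀ {a b s} → a < b → s ≤ a → shift a b s ≡ s
shift-below {a} {b} {s} a<b s≤a rewrite ≥⇒<ᵇ-false {a} {s} s≤a | ≥⇒<ᵇ-false {b} {s} (≤-trans s≤a (<⇒≤ a<b)) = refl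

shift-between : ∀ {a b s} → a < s → s ≤ b → shift a b s ≡ pred s
shift-between {a} {b} {s} a<s s≤b rewrite <⇒<ᵇ-true {a} {s} a<s | ≥⇒<ᵇ-false {b} {s} s≤b = refl

shift-above : ∀ {a b s} → a < b → b < s → shift a b s ≡ pred (pred s)
shift-above {a} {b} {suc (suc s)} a<b b<s rewrite <⇒<ᵇ-true {a} {suc (suc s)} (<-trans a<b b<s) | <⇒<ᵇ-true {b} {suc (suc s)} b<s = refl
shift-above {a} {b} {suc zero} a<b (s≤s b<1) = ⊥-elim (<⇒≱ (<-≤-trans a<b b<1) z≤n)

private
  suc-∸1 : ∀ {a b} → a < b → suc (b ∸ 1) ≡ b
  suc-∸1 {b = suc b} _ = refl

data UnshiftView (a b t : ℕ) : Set where
  below : t < a → unshift a b t ≡ t → UnshiftView a b t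
  between : a ≤ t → suc t < b → unshift a b t ≡ suc t → UnshiftView a b t
  above : b ≤ suc t → unshift a b t ≡ suc (suc t) → UnshiftView a b t

unshift-view : ∀ {a b} t → a < b → UnshiftView a b t
unshift-view {a} {b} t a<b with t <? b ∸ 1
... | yes t<b' with t <? a
...   | yes t<a = below t<a (trans (cong (skip a) (skip-below t<b')) (skip-below t<a))
...   | no t≮a = between (≮⇒≥ t≮a) (subst (suc t <_) (suc-∸1 a<b) (s≤s t<b'))
                         (trans (cong (skip a) (skip-below t<b')) (skip-above (≮⇒≥ t≮a)))
unshift-view {a} {b} t a<b | no t≮b' = above b≤suc-t
  (trans (cong (skip a) (skip-above (≮⇒≥ t≮b'))) (skip-above (≤-trans (<⇒≤ a<b) b≤suc-t)))
  where
  b≤suc-t : b ≤ suc t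
  b≤suc-t = subst (_≤ suc t) (suc-∸1 a<b) (s≤s (≮⇒≥ t≮b'))

data AvoidsView (a b s : ℕ) : Set where
  below : s < a → AvoidsView a b s
  between : a < s → s < b → AvoidsView a b s
  above : b < s → AvoidsView a b s

avoids-view : ∀ {a b s} → Avoids a b s → AvoidsView a b s
avoids-view {a} {b} {s} (≢a , ≢b) with <-cmp s a
... | tri< p _ _ = below p
... | tri≈ _ e _ = ⊥-elim (≢a e)
... | tri> _ _ p with <-cmp s b
...   | tri< q _ _ = between p q
...   | tri≈ _ e _ = ⊥-elim (≢b e)
...   | tri> _ _ q = above q

unshift-avoids : ∀ {a b} t → a < b → Avoids a b (unshift a b t)
unshift-avoids {a} {b} t a<b with unshift-view t a<b
... | below t<a e rewrite e = (λ q → <-irrefl q t<a) , (λ q → <-irrefl q (<-trans t<a a<b))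
... | between a≤t t<b e rewrite e = (λ q → <-irrefl (sym q) (s≤s a≤t)) , (λ q → <-irrefl q t<b)
... | above b≤t e rewrite e = (λ q → <-irrefl (sym q) (<-trans a<b (s≤s b≤t))) , (λ q → <-irrefl (sym q) (s≤s b≤t))

shift-unshift : ∀ {a b} t → a < b → shift a b (unshift a b t) ≡ t
shift-unshift {a} {b} t a<b with unshift-view t a<b
... | below t<a e rewrite e = shift-below a<b (<⇒≤ t<a)
... | between a≤t t<b e rewrite e = shift-between (s≤s a≤t) (<⇒≤ t<b)
... | above b≤t e rewrite e = shift-above a<b (s≤s b≤t)

unshift-shift : ∀ {a b s} → a < b → Avoids a b s → unshift a b (shift a b s) ≡ s
unshift-shift {a} {b} {s} a<b av with avoids-view av
... | below s<a rewrite shift-below a<b (<⇒≤ s<a) with unshift-view s a<b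
...   | below _ e = e
...   | between a≤s _ _ = ⊥-elim (<⇒≱ s<a a≤s)
...   | above b≤s _ = ⊥-elim (<⇒≱ (≤-trans (s≤s s<a) a<b) b≤s)
unshift-shift {a} {b} {suc s} a<b av | between a<s s<b rewrite shift-between {a} {b} {suc s} a<s (<⇒≤ s<b) with unshift-view s a<b
...   | below s<a _ = ⊥-elim (<⇒≱ a<s s<a)
...   | between _ _ e = e
...   | above b≤s _ = ⊥-elim (<⇒≱ s<b b≤s)
unshift-shift {a} {b} {suc (suc s)} a<b av | above b<s rewrite shift-above {a} {b} {suc (suc s)} a<b b<s with unshift-view s a<b
...   | below s<a _ = ⊥-elim (<⇒≱ (≤-trans (s≤s s<a) a<b) (≤-pred b<s))
...   | between _ s<b _ = ⊥-elim (<⇒≱ b<s s<b)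
...   | above _ e = e
unshift-shift {a} {b} {suc zero} a<b av | above (s≤s b<1) = ⊥-elim (<⇒≱ (<-≤-trans a<b b<1) z≤n)

module _ {a b : ℕ} (a<b : a < b) where

  shift-strictMono : ∀ {s s'} → Avoids a b s → Avoids a b s' → s < s' → shift a b s < shift a b s'
  shift-strictMono {s} {s'} av av' lt with <-cmp (shift a b s) (shift a b s')
  ... | tri< p _ _ = p
  ... | tri≈ _ e _ = ⊥-elim (<-irrefl (trans (sym (unshift-shift a<b av)) (trans (cong (unshift a b) e) (unshift-shift a<b av'))) lt)
  ... | tri> _ _ p = ⊥-elim (<-asym lt (subst₂ _<_ (unshift-shift a<b av') (unshift-shift a<b av) (unshift-strictMono a b p)))

  shift-reflects-< : ∀ {s s'} → Avoids a b s → Avoids a b s' → shift a b s < shift a b s' → s < s'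
  shift-reflects-< av av' lt = subst₂ _<_ (unshift-shift a<b av) (unshift-shift a<b av') (unshift-strictMono a b lt)

  unshift-<⇒ : ∀ {s t} → Avoids a b s → unshift a b t < s → t < shift a b s
  unshift-<⇒ {s} {t} av lt = subst (_< shift a b s) (shift-unshift t a<b) (shift-strictMono (unshift-avoids t a<b) av lt)

  <-unshift⇒ : ∀ {s t} → Avoids a b s → s < unshift a b t → shift a b s < t
  <-unshift⇒ {s} {t} av lt = subst (shift a b s <_) (shift-unshift t a<b) (shift-strictMono av (unshift-avoids t a<b) lt)

  <-shift⇒ : ∀ {s t} → Avoids a b s → t < shift a b s → unshift a b t < s
  <-shift⇒ {s} {t} av lt = subst (unshift a b t <_) (unshift-shift a<b av) (unshift-strictMono a b lt)

  module _ {n : ℕ} (1≤a : 1 ≤ a) (b≤n : b ≤ n) where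

    private
      n≡2+ : n ≡ suc (suc (n ∸ 2))
      n≡2+ = sym (trans (+-comm 2 (n ∸ 2)) (m∸n+n≡m (≤-trans (s≤s 1≤a) (≤-trans a<b b≤n))))

    shift-range : ∀ {s} → Avoids a b s → 1 ≤ s → s ≤ n → 1 ≤ shift a b s × shift a b s ≤ n ∸ 2
    shift-range {s} av 1≤s s≤n = unshift-<⇒ av (subst (_< s) (sym unshift-0) 1≤s) , ≤-pred (<-unshift⇒ av s<)
      where
      unshift-0 : unshift a b 0 ≡ 0
      unshift-0 with unshift-view 0 a<b
      ... | below _ e = e
      ... | between a≤0 _ _ = ⊥-elim (<⇒≱ 1≤a a≤0)
      ... | above b≤1 _ = ⊥-elim (<⇒≱ (≤-trans (s≤s 1≤a) a<b) b≤1)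
      s< : s < unshift a b (suc (n ∸ 2))
      s< with unshift-view (suc (n ∸ 2)) a<b
      ... | below t<a _ = ⊥-elim (<⇒≱ (<-≤-trans a<b b≤n) (subst (_≤ a) (sym n≡2+) t<a))
      ... | between _ t<b _ = ⊥-elim (<⇒≱ (subst (_< b) (sym n≡2+) t<b) b≤n)
      ... | above _ e = subst (s <_) (sym e) (subst (s <_) (cong suc n≡2+) (s≤s s≤n))

∑-sites-skip : ∀ n c (g : ℕ → ℕ) → 1 ≤ c → c ≤ n → ∑ (sites n) g ≡ g c + ∑ (sites (n ∸ 1)) (λ t → g (skip c t))
∑-sites-skip zero c g p q = ⊥-elim (<⇒≱ p q)
∑-sites-skip (suc m) c g p q with c ≟ suc m
... | yes refl = cong (g (suc m) +_) (∑-cong (sites m) (λ t mt → cong g (sym (skip-below (s≤s (proj₂ (sites-∈ mt)))))))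
... | no ne with m | ≤-pred (≤∧≢⇒< q ne)
...   | zero | c≤0 = ⊥-elim (<⇒≱ p c≤0)
...   | suc m' | c≤ = begin
      g (suc (suc m')) + ∑ (sites (suc m')) g
        ≡⟨ cong (g (suc (suc m')) +_) (∑-sites-skip (suc m') c g p c≤) ⟩
      g (suc (suc m')) + (g c + rest)
        ≡⟨ x∙yz≈y∙xz (g (suc (suc m'))) (g c) rest ⟩
      g c + (g (suc (suc m')) + rest)
        ≡⟨ cong (λ z → g c + (g z + rest)) (sym (skip-above c≤)) ⟩
      g c + ∑ (sites (suc m')) (λ t → g (skip c t)) ∎
  where
  open ≡-Reasoning
  rest = ∑ (sites m') (λ t → g (skip c t))

∑-sites-unshift : ∀ n a b (g : ℕ → ℕ) → 1 ≤ a → a < b → b ≤ n → g a ≡ 0 → g b ≡ 0 →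
                  ∑ (sites (n ∸ 2)) (λ t → g (unshift a b t)) ≡ ∑ (sites n) g
∑-sites-unshift n a b g 1≤a a<b b≤n ga gb = sym (begin
  ∑ (sites n) g
    ≡⟨ ∑-sites-skip n a g 1≤a (≤-trans (<⇒≤ a<b) b≤n) ⟩
  g a + ∑ (sites (n ∸ 1)) (λ t → g (skip a t))
    ≡⟨ cong (g a +_) (∑-sites-skip (n ∸ 1) (b ∸ 1) (λ t → g (skip a t)) 1≤b∸1 (∸-monoˡ-≤ 1 b≤n)) ⟩
  g a + (g (skip a (b ∸ 1)) + ∑ (sites (n ∸ 1 ∸ 1)) (λ t → g (unshift a b t)))
    ≡⟨ cong₂ (λ x y → x + (g y + ∑ (sites (n ∸ 1 ∸ 1)) (λ t → g (unshift a b t)))) ga skip-a-b∸1 ⟩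
  g b + ∑ (sites (n ∸ 1 ∸ 1)) (λ t → g (unshift a b t))
    ≡⟨ cong₂ (λ x m → x + ∑ (sites m) (λ t → g (unshift a b t))) gb (∸-+-assoc n 1 1) ⟩
  ∑ (sites (n ∸ 2)) (λ t → g (unshift a b t)) ∎)
  where
  open ≡-Reasoning
  1≤b∸1 : 1 ≤ b ∸ 1
  1≤b∸1 = <⇒≤∸1 (≤-trans (s≤s 1≤a) a<b)
  skip-a-b∸1 : skip a (b ∸ 1) ≡ b
  skip-a-b∸1 = trans (skip-above (<⇒≤∸1 a<b)) (trans (+-comm 1 (b ∸ 1)) (m∸n+n≡m (≤-trans (s≤s z≤n) a<b)))

sameArc : Arc → Arc → Bool
sameArc (c , d) (a , b) = (c ≡ᵇ a) ∧ (d ≡ᵇ b)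

sameArc⇒≡ : ∀ β α → sameArc β α ≡ true → β ≡ α
sameArc⇒≡ (c , d) (a , b) e with c ≡ᵇ a in e1 | d ≡ᵇ b in e2
sameArc⇒≡ (c , d) (a , b) refl | true | true = cong₂ _,_ (≡ᵇ-true⇒≡ e1) (≡ᵇ-true⇒≡ e2)

sameArc-refl : ∀ α → sameArc α α ≡ true
sameArc-refl (a , b) rewrite ≡ᵇ-refl a | ≡ᵇ-refl b = refl

removeArc-∷ : ∀ α β S → removeArc α (β ∷ S) ≡ (if sameArc β α then removeArc α S else β ∷ removeArc α S)
removeArc-∷ (a , b) (c , d) S = refl

∈-removeArc⁻ : ∀ α S {β} → β ∈ removeArc α S → β ∈ S × β ≢ α
∈-removeArc⁻ α (γ ∷ S) {β} m rewrite removeArc-∷ α γ S with sameArc γ α in e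
... | true = let (p , q) = ∈-removeArc⁻ α S m in there p , q
∈-removeArc⁻ α (γ ∷ S) {β} (here refl) | false = here refl , λ { refl → case (trans (sym e) (sameArc-refl α)) }
  where case : false ≢ true
        case ()
∈-removeArc⁻ α (γ ∷ S) {β} (there m) | false = let (p , q) = ∈-removeArc⁻ α S m in there p , q

∈-removeArc⁺ : ∀ α S {β} → β ∈ S → β ≢ α → β ∈ removeArc α S
∈-removeArc⁺ α (γ ∷ S) {β} m ne rewrite removeArc-∷ α γ S with sameArc γ α in e | m
... | true | here refl = ⊥-elim (ne (sameArc⇒≡ γ α e))
... | true | there m' = ∈-removeArc⁺ α S m' ne
... | false | here refl = here refl
... | false | there m' = there (∈-removeArc⁺ α S m' ne)

removeArc-∉ : ∀ α S → ¬ α ∈ S → removeArc α S ≡ S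
removeArc-∉ α [] _ = refl
removeArc-∉ α (γ ∷ S) α∉ rewrite removeArc-∷ α γ S with sameArc γ α in e
... | true = ⊥-elim (α∉ (here (sym (sameArc⇒≡ γ α e))))
... | false = cong (γ ∷_) (removeArc-∉ α S (λ m → α∉ (there m)))

∑-removeArc : ∀ α S (g : Arc → ℕ) → Unique S → α ∈ S → ∑ S g ≡ g α + ∑ (removeArc α S) g
∑-removeArc α (γ ∷ S) g (γ∉S ∷ u) m rewrite removeArc-∷ α γ S with sameArc γ α in e
... | true with sameArc⇒≡ γ α e
...   | refl = cong (λ L → g γ + ∑ L g) (sym (removeArc-∉ γ S (λ m' → All.lookup γ∉S m' refl)))
∑-removeArc α (γ ∷ S) g (γ∉S ∷ u) (here refl) | false = ⊥-elim (case (trans (sym e) (sameArc-refl α)))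
  where case : false ≢ true
        case ()
∑-removeArc α (γ ∷ S) g (γ∉S ∷ u) (there m) | false =
  trans (cong (g γ +_) (∑-removeArc α S g u m)) (x∙yz≈y∙xz (g γ) (g α) _)

AllPairs-removeArc : ∀ {R : Arc → Arc → Set} α S → AllPairs R S → AllPairs R (removeArc α S)
AllPairs-removeArc α [] [] = []
AllPairs-removeArc α (γ ∷ S) (γR ∷ r) rewrite removeArc-∷ α γ S with sameArc γ α
... | true = AllPairs-removeArc α S r
... | false = tabulate (λ m → All.lookup γR (proj₁ (∈-removeArc⁻ α S m))) ∷ AllPairs-removeArc α S r

length-removeArc : ∀ α S → Unique S → α ∈ S → suc (length (removeArc α S)) ≡ length S
length-removeArc α S u m =
  trans (cong suc (sym (∑1≡length (removeArc α S)))) (trans (sym (∑-removeArc α S (λ _ → 1) u m)) (∑1≡length S))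

AllPairs-map⁺ : ∀ {A : Set} {R : A → A → Set} {P : A → Set} (g : A → A) →
                (∀ {x y} → P x → P y → R x y → R (g x) (g y)) → ∀ {xs} → All P xs → AllPairs R xs → AllPairs R (map g xs)
AllPairs-map⁺ g g-resp [] [] = []
AllPairs-map⁺ g g-resp (px ∷ ps) (rx ∷ rs) = heads ps rx ∷ AllPairs-map⁺ g g-resp ps rs
  where
  heads : ∀ {ys} → All _ ys → All _ ys → All _ (map g ys)
  heads [] [] = []
  heads (py ∷ ps') (ry ∷ rs') = g-resp px py ry ∷ heads ps' rs'

relabel : ℕ → ℕ → Arc → Arc
relabel a b (c , d) = (shift a b c , shift a b d)

covered∧¬first-to-last⇒ValidArc : ∀ {n S c d} → ArcsWithin n S → (c , d) ∈ S →
  ∃ (λ u → Free n S u × Covered u (c , d)) → (block n S c ≡ 1 → block n S d ≢ suc (nFree n S)) → ValidArc n (c , d)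
covered∧¬first-to-last⇒ValidArc {n} {S} {c} {d} within m (u , _ , c<u , u<d) ¬first-to-last =
  1≤c , c<d , d≤n , 1<d∸c , d∸c<n∸1
  where
  1≤c = proj₁ (within _ m)
  c<d = proj₁ (proj₂ (within _ m))
  d≤n = proj₂ (proj₂ (within _ m))
  1<d∸c : 1 < d ∸ c
  1<d∸c = ≤-trans (≤-reflexive (sym (m+n∸n≡m 2 c))) (∸-monoˡ-≤ c (≤-trans (s≤s c<u) u<d))
  room : 2 ≤ c ⊎ d < n
  room with block n S c ≟ 1
  ... | no ≢1 = let (v , (1≤v , _) , v<c) = block≢1⇒free-below n S ≢1 in inj₁ (≤-trans (s≤s 1≤v) v<c)
  ... | yes first = let (v , (_ , v≤n , free) , d≤v) = block≢last⇒free-above n S (¬first-to-last first) in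
        inj₂ (<-≤-trans (≤∧≢⇒< d≤v (λ d≡v → deg≡0⇒¬Supports free m (inj₂ (sym d≡v)))) v≤n)
  d∸c<n∸1 : d ∸ c < n ∸ 1
  d∸c<n∸1 with room
  ... | inj₁ 2≤c = ≤-<-trans (∸-mono d≤n 2≤c) (∸-monoʳ-< (s≤s ≤-refl) (≤-trans 2≤c (≤-trans (<⇒≤ c<d) d≤n)))
  ... | inj₂ d<n = ≤-<-trans (∸-monoʳ-≤ d 1≤c) (∸-monoˡ-< d<n (≤-trans 1≤c (<⇒≤ c<d)))

¬first-to-last⇒¬covers-all : ∀ {n S c d} → (c , d) ∈ S → (block n S c ≡ 1 → block n S d ≢ suc (nFree n S)) →
                             ¬ (∀ s → Free n S s → Covered s (c , d))
¬first-to-last⇒¬covers-all {n} {S} {c} {d} m ¬first-to-last covers-all with block n S c ≟ 1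
... | no ≢1 = let (v , F , v<c) = block≢1⇒free-below n S ≢1 in <-asym v<c (proj₁ (covers-all v F))
... | yes first = let (v , F , d≤v) = block≢last⇒free-above n S (¬first-to-last first) in <⇒≱ (proj₂ (covers-all v F)) d≤v

module Suppression {n : ℕ} {X : List Arc} {a b : ℕ}
                   (within : ArcsWithin n X) (sorted : Sorted X) (deg≤1 : Deg≤1 X) (mα : (a , b) ∈ X) where

  X' = suppress (a , b) X
  n' = n ∸ 2
  rest = removeArc (a , b) X

  1≤a : 1 ≤ a
  1≤a = proj₁ (within _ mα)
  a<b : a < b
  a<b = proj₁ (proj₂ (within _ mα))
  b≤n : b ≤ n
  b≤n = proj₂ (proj₂ (within _ mα))

  others-avoid : ∀ {c d} → (c , d) ∈ X → (c , d) ≢ (a , b) → Avoids a b c × Avoids a b d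
  others-avoid m ne =
      ((λ { refl → ne (supporting-arc-unique deg≤1 m mα (inj₁ refl) (inj₁ refl)) }) ,
       (λ { refl → ne (supporting-arc-unique deg≤1 m mα (inj₁ refl) (inj₂ refl)) }))
    , ((λ { refl → ne (supporting-arc-unique deg≤1 m mα (inj₂ refl) (inj₁ refl)) }) ,
       (λ { refl → ne (supporting-arc-unique deg≤1 m mα (inj₂ refl) (inj₂ refl)) }))

  free-avoids : ∀ {s} → Free n X s → Avoids a b s
  free-avoids (_ , _ , free) = (λ { refl → deg≡0⇒¬Supports free mα (inj₁ refl) }) , (λ { refl → deg≡0⇒¬Supports free mα (inj₂ refl) })

  ∈-X'⁻ : ∀ {β'} → β' ∈ X' → ∃ λ β → β ∈ X × β ≢ (a , b) × β' ≡ relabel a b β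
  ∈-X'⁻ m = let (β , mr , e) = ∈-map⁻ (relabel a b) m ; (p , q) = ∈-removeArc⁻ (a , b) X mr in β , p , q , e

  ∈-X'⁺ : ∀ {β} → β ∈ X → β ≢ (a , b) → relabel a b β ∈ X'
  ∈-X'⁺ m ne = ∈-map⁺ (relabel a b) (∈-removeArc⁺ (a , b) X m ne)

  ∑-X' : ∀ (g : Arc → ℕ) → ∑ X' g ≡ ∑ rest (λ β → g (relabel a b β))
  ∑-X' g = ∑-map (relabel a b) rest g

  deg-X' : ∀ t → deg X' t ≡ deg X (unshift a b t)
  deg-X' t = begin
    deg X' t                                            ≡⟨ deg≡∑arcDeg X' t ⟩
    ∑ X' (arcDeg t)                                     ≡⟨ ∑-X' (arcDeg t) ⟩
    ∑ rest (λ β → arcDeg t (relabel a b β))             ≡⟨ ∑-cong rest relabelled ⟩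
    ∑ rest (arcDeg (unshift a b t))                     ≡⟨ cong (_+ ∑ rest (arcDeg (unshift a b t))) α-misses ⟨
    arcDeg (unshift a b t) (a , b) + ∑ rest (arcDeg (unshift a b t)) ≡⟨ ∑-removeArc (a , b) X _ (Sorted⇒Unique sorted) mα ⟨
    ∑ X (arcDeg (unshift a b t))                        ≡⟨ deg≡∑arcDeg X (unshift a b t) ⟨
    deg X (unshift a b t)                               ∎
    where
    open ≡-Reasoning
    shift≡ᵇ : ∀ {c} → Avoids a b c → (shift a b c ≡ᵇ t) ≡ (c ≡ᵇ unshift a b t)
    shift≡ᵇ av = ≡ᵇ-cong (λ e → trans (sym (unshift-shift a<b av)) (cong (unshift a b) e))
                         (λ e → trans (cong (shift a b) e) (shift-unshift t a<b))
    relabelled : ∀ β → β ∈ rest → arcDeg t (relabel a b β) ≡ arcDeg (unshift a b t) β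
    relabelled (c , d) m = let (p , q) = ∈-removeArc⁻ (a , b) X m ; (av₁ , av₂) = others-avoid p q in
      cong₂ (λ x y → χ x + χ y) (shift≡ᵇ av₁) (shift≡ᵇ av₂)
    α-misses : arcDeg (unshift a b t) (a , b) ≡ 0
    α-misses = ¬Supports⇒arcDeg≡0 _ (a , b) (λ { (inj₁ e) → proj₁ (unshift-avoids t a<b) e ; (inj₂ e) → proj₂ (unshift-avoids t a<b) e })

  deg-X'-shift : ∀ {s} → Avoids a b s → deg X' (shift a b s) ≡ deg X s
  deg-X'-shift {s} av = trans (deg-X' (shift a b s)) (cong (deg X) (unshift-shift a<b av))

  within' : ArcsWithin n' X'
  within' β' m with ∈-X'⁻ m
  ... | ((c , d) , p , q , refl) =
    let (1≤c , c<d , d≤n) = within (c , d) p ; (av₁ , av₂) = others-avoid p q in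
    proj₁ (shift-range a<b 1≤a b≤n av₁ 1≤c (≤-trans (<⇒≤ c<d) d≤n)) , shift-strictMono a<b av₁ av₂ c<d ,
    proj₂ (shift-range a<b 1≤a b≤n av₂ (≤-trans 1≤c (<⇒≤ c<d)) d≤n)

  sorted' : Sorted X'
  sorted' = AllPairs-map⁺ (relabel a b) relabel-< (tabulate rest-avoids) (AllPairs-removeArc (a , b) X sorted)
    where
    BothAvoid : Arc → Set
    BothAvoid (c , d) = Avoids a b c × Avoids a b d
    rest-avoids : ∀ {β} → β ∈ rest → BothAvoid β
    rest-avoids {c , d} m = let (p , q) = ∈-removeArc⁻ (a , b) X m in others-avoid p q
    relabel-< : ∀ {x y} → BothAvoid x → BothAvoid y → x <ₐ y → relabel a b x <ₐ relabel a b y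
    relabel-< {c , d} {c' , d'} (p₁ , _) (q₁ , _) (inj₁ lt) = inj₁ (shift-strictMono a<b p₁ q₁ lt)
    relabel-< {c , d} {c' , d'} (_ , p₂) (_ , q₂) (inj₂ (refl , lt)) = inj₂ (refl , shift-strictMono a<b p₂ q₂ lt)

  deg≤1' : Deg≤1 X'
  deg≤1' t = subst (_≤ 1) (sym (deg-X' t)) (deg≤1 (unshift a b t))

  a-supported : deg X a ≢ 0
  a-supported e = deg≡0⇒¬Supports e mα (inj₁ refl)
  b-supported : deg X b ≢ 0
  b-supported e = deg≡0⇒¬Supports e mα (inj₂ refl)

  nFreeBelow-X' : ∀ {s} → Avoids a b s → nFreeBelow n' X' (shift a b s) ≡ nFreeBelow n X s
  nFreeBelow-X' {s} av = begin
    nFreeBelow n' X' (shift a b s)                                  ≡⟨ nFreeBelow≡∑ n' X' (shift a b s) ⟩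
    ∑ (sites n') (λ t → χ (free? X' t ∧ (t <ᵇ shift a b s)))        ≡⟨ ∑-cong (sites n') relabelled ⟩
    ∑ (sites n') (λ t → g (unshift a b t))                          ≡⟨ ∑-sites-unshift n a b g 1≤a a<b b≤n (g-supported a-supported) (g-supported b-supported) ⟩
    ∑ (sites n) g                                                   ≡⟨ nFreeBelow≡∑ n X s ⟨
    nFreeBelow n X s                                                ∎
    where
    open ≡-Reasoning
    g : ℕ → ℕ
    g u = χ (free? X u ∧ (u <ᵇ s))
    relabelled : ∀ t → t ∈ sites n' → χ (free? X' t ∧ (t <ᵇ shift a b s)) ≡ g (unshift a b t)
    relabelled t _ = cong₂ (λ x y → χ (x ∧ y)) (cong (_≡ᵇ 0) (deg-X' t)) (<ᵇ-cong (<-shift⇒ a<b av) (unshift-<⇒ a<b av))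
    g-supported : ∀ {u} → deg X u ≢ 0 → g u ≡ 0
    g-supported {u} ne = cong (λ z → χ (z ∧ (u <ᵇ s))) (≢⇒≡ᵇ-false ne)

  nFree-X' : nFree n' X' ≡ nFree n X
  nFree-X' = begin
    nFree n' X'                                   ≡⟨ nFree≡∑ n' X' ⟩
    ∑ (sites n') (λ t → χ (free? X' t))           ≡⟨ ∑-cong (sites n') (λ t _ → cong (λ z → χ (z ≡ᵇ 0)) (deg-X' t)) ⟩
    ∑ (sites n') (λ t → χ (free? X (unshift a b t))) ≡⟨ ∑-sites-unshift n a b _ 1≤a a<b b≤n (g-supported a-supported) (g-supported b-supported) ⟩
    ∑ (sites n) (λ u → χ (free? X u))             ≡⟨ nFree≡∑ n X ⟨
    nFree n X                                     ∎
    where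
    open ≡-Reasoning
    g-supported : ∀ {u} → deg X u ≢ 0 → χ (free? X u) ≡ 0
    g-supported ne = cong χ (≢⇒≡ᵇ-false ne)

  block-X' : ∀ {s} → Avoids a b s → block n' X' (shift a b s) ≡ block n X s
  block-X' av = cong suc (nFreeBelow-X' av)

  blockMatrix-X' : ∀ i j → blockMatrix n' X' i j ≤ blockMatrix n X i j
  blockMatrix-X' i j = begin
    blockMatrix n' X' i j                                 ≡⟨ blockMatrix≡∑ n' X' i j ⟩
    ∑ X' (λ β → χ (joins n' X' i j β))                    ≡⟨ ∑-X' _ ⟩
    ∑ rest (λ β → χ (joins n' X' i j (relabel a b β)))    ≡⟨ ∑-cong rest relabelled ⟩
    ∑ rest (λ β → χ (joins n X i j β))                    ≤⟨ m≤n+m _ _ ⟩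
    χ (joins n X i j (a , b)) + ∑ rest (λ β → χ (joins n X i j β)) ≡⟨ ∑-removeArc (a , b) X _ (Sorted⇒Unique sorted) mα ⟨
    ∑ X (λ β → χ (joins n X i j β))                       ≡⟨ blockMatrix≡∑ n X i j ⟨
    blockMatrix n X i j                                   ∎
    where
    open ≤-Reasoning
    relabelled : ∀ β → β ∈ rest → χ (joins n' X' i j (relabel a b β)) ≡ χ (joins n X i j β)
    relabelled (c , d) m = let (p , q) = ∈-removeArc⁻ (a , b) X m ; (av₁ , av₂) = others-avoid p q in
      cong₂ (λ x y → χ (((x ≡ᵇ i) ∧ (y ≡ᵇ j)) ∨ ((x ≡ᵇ j) ∧ (y ≡ᵇ i)))) (block-X' av₁) (block-X' av₂)

  length-X' : suc (length X') ≡ length X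
  length-X' = trans (cong suc (length-map (relabel a b) rest)) (length-removeArc (a , b) X (Sorted⇒Unique sorted) mα)

  Relabels : Arc → Arc → Set
  Relabels (c , d) β' = β' ≡ relabel a b (c , d) × Avoids a b c × Avoids a b d

  ∈-X'⇒Relabels : ∀ {β'} → β' ∈ X' → ∃ λ β → β ∈ X × Relabels β β'
  ∈-X'⇒Relabels m with ∈-X'⁻ m
  ... | ((c , d) , p , q , e) = (c , d) , p , e , others-avoid p q

  Relabels-cross : ∀ {β γ β' γ'} → Relabels β β' → Relabels γ γ' → Cross β' γ' → Cross β γ
  Relabels-cross {c , d} {c' , d'} (refl , p₁ , p₂) (refl , q₁ , q₂) (inj₁ (x , y , z)) =
    inj₁ (shift-reflects-< a<b p₁ q₁ x , shift-reflects-< a<b q₁ p₂ y , shift-reflects-< a<b p₂ q₂ z)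
  Relabels-cross {c , d} {c' , d'} (refl , p₁ , p₂) (refl , q₁ , q₂) (inj₂ (x , y , z)) =
    inj₂ (shift-reflects-< a<b q₁ p₁ x , shift-reflects-< a<b p₁ q₂ y , shift-reflects-< a<b q₂ p₂ z)

  Relabels-supports : ∀ {β β' x} → Relabels β β' → Supports x β' → Supports (unshift a b x) β
  Relabels-supports {c , d} (refl , av₁ , _) (inj₁ refl) = inj₁ (unshift-shift a<b av₁)
  Relabels-supports {c , d} (refl , _ , av₂) (inj₂ refl) = inj₂ (unshift-shift a<b av₂)

  block-X'≡block-unshift : ∀ x → block n' X' x ≡ block n X (unshift a b x)
  block-X'≡block-unshift x = trans (cong (block n' X') (sym (shift-unshift x a<b))) (block-X' (unshift-avoids x a<b))

  Free-X' : ∀ {s} → Free n X s → Free n' X' (shift a b s)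
  Free-X' F@(1≤s , s≤n , free) = let (lo , hi) = shift-range a<b 1≤a b≤n (free-avoids F) 1≤s s≤n in
    lo , hi , trans (deg-X'-shift (free-avoids F)) free

R0-suppress : ∀ {f k n X a b} → R0 f k n X → (a , b) ∈ X → NonTrivial (suppress (a , b) X) → R0 f k (n ∸ 2) (suppress (a , b) X)
R0-suppress {f} {k} {n} {X} {a} {b} (P@((valid , linked) , ((_ , deg≤1) , covers , ¬covers-all) , kX , nFree≡f , taut≡0) , (_ , regular)) mα nt' =
  ((tabulate (λ m → covered∧¬first-to-last⇒ValidArc within' m (covers' _ m) (¬first-to-last' m)) , Sorted⇒Linked sorted') ,
   ((nt' , deg≤1') , covers' , ¬covers-all') ,
   KNoncrossing-reflect Relabels ∈-X'⇒Relabels Relabels-cross kX ,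
   trans nFree-X' nFree≡f ,
   taut≡0') ,
  ((nt' , deg≤1') , regular')
  where
  open Suppression (ValidArcs⇒ArcsWithin valid) (Linked⇒Sorted linked) deg≤1 mα
  covers' : ∀ β' → β' ∈ X' → ∃ λ s → Free n' X' s × Covered s β'
  covers' β' m with ∈-X'⁻ m
  ... | ((c , d) , p , q , refl) with covers (c , d) p | others-avoid p q
  ...   | (u , F , c<u , u<d) | (av₁ , av₂) =
    shift a b u , Free-X' F , shift-strictMono a<b av₁ (free-avoids F) c<u , shift-strictMono a<b (free-avoids F) av₂ u<d
  ¬covers-all' : ∀ β' → β' ∈ X' → ¬ (∀ s → Free n' X' s → Covered s β')
  ¬covers-all' β' m covers-all' with ∈-X'⁻ m
  ... | ((c , d) , p , q , refl) = ¬covers-all (c , d) p covers-all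
    where
    covers-all : ∀ s → Free n X s → Covered s (c , d)
    covers-all s F = let (av₁ , av₂) = others-avoid p q ; (x , y) = covers-all' (shift a b s) (Free-X' F) in
      shift-reflects-< a<b av₁ (free-avoids F) x , shift-reflects-< a<b (free-avoids F) av₂ y
  ¬first-to-last' : ∀ {c d} → (c , d) ∈ X' → block n' X' c ≡ 1 → block n' X' d ≢ suc (nFree n' X')
  ¬first-to-last' m first last with ∈-X'⁻ m
  ... | ((c , d) , p , q , refl) = let (av₁ , av₂) = others-avoid p q in
    P0Shape.¬first-to-last (P0⇒P0Shape P) p (trans (sym (block-X' av₁)) first)
      (trans (sym (block-X' av₂)) (trans last (cong suc (trans nFree-X' nFree≡f))))
  taut≡0' : tautology (n ∸ 2) X' ≡ 0
  taut≡0' = n≤0⇒n≡0 (≤-trans (≤-reflexive (cong (λ g → tautologyOf g (blockMatrix n' X')) nFree-X'))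
                             (≤-trans (tautologyOf-mono (nFree n X) blockMatrix-X') (≤-reflexive taut≡0)))
  regular' : ∀ β' γ' → β' ∈ X' → γ' ∈ X' → Cross β' γ' → ∀ x y → Supports x β' → Supports y γ' → block n' X' x ≢ block n' X' y
  regular' β' γ' mβ mγ cr x y sx sy e with ∈-X'⇒Relabels mβ | ∈-X'⇒Relabels mγ
  ... | (β , pβ , rβ) | (γ , pγ , rγ) =
    regular β γ pβ pγ (Relabels-cross rβ rγ cr) _ _ (Relabels-supports rβ sx) (Relabels-supports rγ sy)
      (trans (sym (block-X'≡block-unshift x)) (trans e (block-X'≡block-unshift y)))

-- The map Ψ

module _ (f : ℕ) where

  joined? : ℕ → List Arc → Arc → Bool
  joined? n S e = 0 <ᵇ blockMatrix n S (proj₁ e) (proj₂ e)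

  Ψ : ℕ → List Arc → List Arc
  Ψ n S = filterᵇ (joined? n S) (pairs (suc f))

  Ψ-sorted : ∀ n S → Sorted (Ψ n S)
  Ψ-sorted n S = APP.filter⁺ (T? ∘ joined? n S) (pairs-sorted (suc f))

  ∈Ψ⁻ : ∀ {n S i j} → (i , j) ∈ Ψ n S → 1 ≤ i × i < j × j ≤ suc f × 1 ≤ blockMatrix n S i j
  ∈Ψ⁻ {n} {S} m with ∈-filter⁻ (T? ∘ joined? n S) {xs = pairs (suc f)} m
  ... | (p , t) = let (u , v , w) = ∈-pairs⁻ (suc f) p in u , v , w , <ᵇ⇒< 0 _ t

  ∈Ψ⁺ : ∀ {n S i j} → 1 ≤ i → i < j → j ≤ suc f → 1 ≤ blockMatrix n S i j → (i , j) ∈ Ψ n S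
  ∈Ψ⁺ {n} {S} u v w b = ∈-filter⁺ (T? ∘ joined? n S) (∈-pairs⁺ (suc f) u v w) (<⇒<ᵇ b)

  Ψ-increasing : ∀ n S → Increasing (Ψ n S)
  Ψ-increasing n S {i , j} m = proj₁ (proj₂ (∈Ψ⁻ {n} {S} m))

  Ψ-mono : ∀ {n S n' S'} → (∀ i j → blockMatrix n' S' i j ≤ blockMatrix n S i j) → Ψ n' S' ⊆ Ψ n S
  Ψ-mono {n} {S} {n'} {S'} le {i , j} m with ∈Ψ⁻ {n'} {S'} m
  ... | (p , q , r , b) = ∈Ψ⁺ {n} {S} p q r (≤-trans b (le i j))

  module _ {n : ℕ} {S : List Arc} (shape : P0Shape f n S) where
    open P0Shape shape

    BlockImage : Arc → Arc → Set
    BlockImage (a , b) e = (block n S a , block n S b) ≡ e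

    ∈Ψ⇒arc : ∀ {e} → e ∈ Ψ n S → ∃ λ α → α ∈ S × BlockImage α e
    ∈Ψ⇒arc {i , j} m with ∈Ψ⁻ {n} {S} m
    ... | (_ , i<j , _ , 1≤b) with 1≤blockMatrix⇒arc n S i j 1≤b
    ...   | (a , b , ma , inj₁ (refl , refl)) = (a , b) , ma , refl
    ...   | (a , b , ma , inj₂ (refl , refl)) = ⊥-elim (<-asym i<j (blocks-< ma))

    arc⇒∈Ψ : ∀ {a b} → (a , b) ∈ S → (block n S a , block n S b) ∈ Ψ n S
    arc⇒∈Ψ m = ∈Ψ⁺ {n} {S} (s≤s z≤n) (blocks-< m) (block≤suc-f m) (arc⇒1≤blockMatrix n S m)

    -- Apart blocks give length ≥ 2, and an arc starting in the first block cannot end in the last one.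
    Ψ-valid : ∀ {e} → e ∈ Ψ n S → ValidArc (suc f) e
    Ψ-valid m with ∈Ψ⁻ {n} {S} m | ∈Ψ⇒arc m
    ... | (1≤i , i<j , j≤ , _) | ((a , b) , ma , refl) = 1≤i , i<j , j≤ , 1<j∸i , j∸i<f
      where
      1<j∸i : 1 < block n S b ∸ block n S a
      1<j∸i = ≤-trans (≤-reflexive (sym (m+n∸n≡m 2 (block n S a)))) (∸-monoˡ-≤ (block n S a) (blocks-apart ma))
      j∸i<f : block n S b ∸ block n S a < f
      j∸i<f with block n S a ≟ 1 | block n S b ≟ suc f
      ... | yes first | yes last = ⊥-elim (¬first-to-last ma first last)
      ... | yes first | no ¬last = subst (λ z → block n S b ∸ z < f) (sym first) (≤-pred (≤∧≢⇒< j≤ ¬last))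
      ... | no ¬first | _ = ≤-pred (subst (_≤ suc f) (+-comm (block n S b ∸ block n S a) 2)
              (≤-trans (+-monoʳ-≤ _ (≤∧≢⇒< 1≤i (≢-sym ¬first)))
                       (≤-trans (≤-reflexive (m∸n+n≡m (<⇒≤ i<j))) j≤)))

    Ψ-KNoncrossing : ∀ {k} → KNoncrossing k S → KNoncrossing k (Ψ n S)
    Ψ-KNoncrossing = KNoncrossing-reflect BlockImage ∈Ψ⇒arc reflect
      where
      reflect : ∀ {β γ β' γ'} → BlockImage β β' → BlockImage γ γ' → Cross β' γ' → Cross β γ
      reflect {a , b} {c , d} refl refl (inj₁ (p , q , r)) = inj₁ (block-<⇒< n S p , block-<⇒< n S q , block-<⇒< n S r)
      reflect {a , b} {c , d} refl refl (inj₂ (p , q , r)) = inj₂ (block-<⇒< n S p , block-<⇒< n S q , block-<⇒< n S r)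

    blockMatrix-diagonal : ∀ i → blockMatrix n S i i ≡ 0
    blockMatrix-diagonal i = trans (blockMatrix≡∑ n S i i) (∑-zero S _ no-loop)
      where
      no-loop : ∀ α → α ∈ S → χ (joins n S i i α) ≡ 0
      no-loop (a , b) m with joins n S i i (a , b) in eq
      ... | false = refl
      ... | true with ∨-∧-true⇒ (block n S a ≡ᵇ i) (block n S b ≡ᵇ i) (block n S a ≡ᵇ i) (block n S b ≡ᵇ i) eq
      ...   | inj₁ (e1 , e2) = ⊥-elim (<-irrefl (trans (≡ᵇ-true⇒≡ {block n S a} {i} e1) (sym (≡ᵇ-true⇒≡ {block n S b} {i} e2))) (blocks-< m))
      ...   | inj₂ (e1 , e2) = ⊥-elim (<-irrefl (trans (≡ᵇ-true⇒≡ {block n S a} {i} e1) (sym (≡ᵇ-true⇒≡ {block n S b} {i} e2))) (blocks-< m))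

    adjMatrix-Ψ-below : ∀ {i j} → 1 ≤ i → i < j → j ≤ suc f → adjMatrix (Ψ n S) i j ≡ blockMatrix n S i j
    adjMatrix-Ψ-below {i} {j} 1≤i i<j j≤ =
      ≤1-≡ (adjMatrix≤1 (Ψ n S) i j) (blockMatrix≤1 1≤i i<j j≤)
           (λ p → proj₂ (proj₂ (proj₂ (∈Ψ⁻ {n} {S} (1≤adjMatrix⇒∈ (Ψ-increasing n S) i<j p)))))
           (λ p → ≤-reflexive (sym (∈⇒adjMatrix≡1 (∈Ψ⁺ {n} {S} 1≤i i<j j≤ p))))

    adjMatrix-Ψ : AdjEq (suc f) (Ψ n S) (blockMatrix n S)
    adjMatrix-Ψ i j 1≤i i≤ 1≤j j≤ with <-cmp i j
    ... | tri< i<j _ _ = adjMatrix-Ψ-below 1≤i i<j j≤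
    ... | tri≈ _ refl _ = trans (adjMatrix-diagonal (Ψ-increasing n S) i) (sym (blockMatrix-diagonal i))
    ... | tri> _ _ j<i = trans (adjMatrix-sym (Ψ n S) i j) (trans (adjMatrix-Ψ-below 1≤j j<i i≤) (blockMatrix-sym n S j i))

    Ψ-nonTrivial : NonTrivial S → NonTrivial (Ψ n S)
    Ψ-nonTrivial nt = mem⇒nonempty (arc⇒∈Ψ (proj₂ (nonempty⇒∃∈ nt)))

  Ψ-wellDefined : ∀ {k n S} → P0 f k n S → SD (suc f) k (Ψ n S) × AdjEq (suc f) (Ψ n S) (blockMatrix n S)
  Ψ-wellDefined {n = n} {S} P@(_ , ((nt , _) , _) , kS , _) =
    ((tabulate (Ψ-valid shape) , Sorted⇒Linked (Ψ-sorted n S)) , Ψ-nonTrivial shape nt , Ψ-KNoncrossing shape kS) ,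
    adjMatrix-Ψ shape
    where shape = P0⇒P0Shape P

  Ψ-unique : ∀ n S T → IsDiagram (suc f) T → AdjEq (suc f) T (blockMatrix n S) → T ≡ Ψ n S
  Ψ-unique n S T (valid , linked) adjEq = Sorted-extensional T (Ψ n S) (Linked⇒Sorted linked) (Ψ-sorted n S) T⊆Ψ Ψ⊆T
    where
    adjEq< : ∀ {i j} → 1 ≤ i → i < j → j ≤ suc f → adjMatrix T i j ≡ blockMatrix n S i j
    adjEq< 1≤i i<j j≤ = adjEq _ _ 1≤i (≤-trans (<⇒≤ i<j) j≤) (≤-trans 1≤i (<⇒≤ i<j)) j≤
    T⊆Ψ : ∀ {e} → e ∈ T → e ∈ Ψ n S
    T⊆Ψ {i , j} m = let (1≤i , i<j , j≤ , _) = All.lookup valid m in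
      ∈Ψ⁺ {n} {S} 1≤i i<j j≤ (≤-reflexive (trans (sym (∈⇒adjMatrix≡1 m)) (adjEq< 1≤i i<j j≤)))
    Ψ⊆T : ∀ {e} → e ∈ Ψ n S → e ∈ T
    Ψ⊆T {i , j} m = let (1≤i , i<j , j≤ , 1≤b) = ∈Ψ⁻ {n} {S} m in
      1≤adjMatrix⇒∈ (ValidArcs⇒Increasing valid) i<j (subst (1 ≤_) (sym (adjEq< 1≤i i<j j≤)) 1≤b)

  Ψ-≼-mono : ∀ {n S n' S'} → ArcsWithin n' S' → Sorted S' → Deg≤1 S' → (n , S) ≼ (n' , S') → Ψ n S ⊆ Ψ n' S'
  Ψ-≼-mono _ _ _ ≼-refl m = m
  Ψ-≼-mono {n} {S} {n'} {S'} within sorted deg≤1 (≼-step {α = (a , b)} mα rest) =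
    λ m → Ψ-mono {n'} {S'} {n' ∸ 2} {suppress (a , b) S'} Sup.blockMatrix-X'
            (Ψ-≼-mono {n} {S} {n' ∸ 2} {suppress (a , b) S'} Sup.within' Sup.sorted' Sup.deg≤1' rest m)
    where module Sup = Suppression within sorted deg≤1 mα

  -- Endpoint order inside a block, and injectivity on ℛ⁰

  -- Inside a block, the endpoints of a regular 𝒫⁰-diagram come in a forced order: first the arcs
  -- going left, nearest partner block first, then the arcs going right, farthest partner block
  -- first.  rank encodes this order; W exceeds every block index, so right-going arcs rank last.
  W : ℕ
  W = suc (suc (suc (suc (f + f))))

  rank : ℕ → ℕ → ℕ
  rank i p = if p <ᵇ i then i ∸ p else W ∸ p

  -- A half-arc (i , p) is an endpoint in block i of an arc whose other endpoint lies in block p.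
  key : Arc → Arc
  key (i , p) = (i , rank i p)

  _≺_ : Arc → Arc → Set
  h ≺ h' = key h <ₐ key h'

  _≺ᵇ_ : Arc → Arc → Bool
  h ≺ᵇ h' = does (key h <ₐ? key h')

  ≺-irrefl : ∀ {h} → ¬ h ≺ h
  ≺-irrefl = <ₐ-irrefl

  ≺-trans : ∀ {h h' h''} → h ≺ h' → h' ≺ h'' → h ≺ h''
  ≺-trans = <ₐ-trans

  ≺-asym : ∀ {h h'} → h ≺ h' → ¬ h' ≺ h
  ≺-asym p q = ≺-irrefl (≺-trans p q)

  ≺⇒block≤ : ∀ {h h'} → h ≺ h' → proj₁ h ≤ proj₁ h'
  ≺⇒block≤ (inj₁ lt) = <⇒≤ lt
  ≺⇒block≤ (inj₂ (e , _)) = ≤-reflexive e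

  rank-left : ∀ {i p} → p < i → rank i p ≡ i ∸ p
  rank-left {i} {p} lt rewrite <⇒<ᵇ-true lt = refl

  rank-right : ∀ {i p} → i ≤ p → rank i p ≡ W ∸ p
  rank-right {i} {p} le rewrite ≥⇒<ᵇ-false {p} {i} le = refl

  ≤W : ∀ {p} → p ≤ suc f → p ≤ W
  ≤W p≤ = ≤-trans p≤ (s≤s (≤-trans (m≤m+n f f) (≤-trans (n≤1+n _) (≤-trans (n≤1+n _) (n≤1+n _)))))

  rank-left-left : ∀ {i p q} → q < p → p < i → rank i p < rank i q
  rank-left-left q<p p<i = subst₂ _<_ (sym (rank-left p<i)) (sym (rank-left (<-trans q<p p<i))) (∸-monoʳ-< q<p (<⇒≤ p<i))

  rank-right-right : ∀ {i p q} → i < q → q < p → p ≤ suc f → rank i p < rank i q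
  rank-right-right i<q q<p p≤ = subst₂ _<_ (sym (rank-right (<⇒≤ (<-trans i<q q<p)))) (sym (rank-right (<⇒≤ i<q)))
                                         (∸-monoʳ-< q<p (≤W p≤))

  rank-left-right : ∀ {i p q} → p < i → i < q → q ≤ suc f → rank i p < rank i q
  rank-left-right {i} {p} {q} p<i i<q q≤ = subst₂ _<_ (sym (rank-left p<i)) (sym (rank-right (<⇒≤ i<q))) i∸p<W∸q
    where
    i∸p<W∸q : i ∸ p < W ∸ q
    i∸p<W∸q = ≤-trans (s≤s (≤-trans (m∸n≤m i p) (≤-pred (≤-trans i<q q≤))))
                      (≤-trans (≤-trans (n≤1+n _) (n≤1+n _))
                               (≤-trans (≤-reflexive (sym (m+n∸n≡m (suc (suc (suc f))) f))) (∸-monoʳ-≤ W q≤)))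

  rank-injective : ∀ {i p q} → p ≢ i → q ≢ i → p ≤ suc f → q ≤ suc f → rank i p ≡ rank i q → p ≡ q
  rank-injective {i} {p} {q} p≢i q≢i p≤ q≤ e with <-cmp p i | <-cmp q i
  ... | tri≈ _ x _ | _ = ⊥-elim (p≢i x)
  ... | _ | tri≈ _ x _ = ⊥-elim (q≢i x)
  ... | tri< p<i _ _ | tri< q<i _ _ = sym (∸-cancelˡ-≡ (<⇒≤ q<i) (<⇒≤ p<i) (trans (sym (rank-left q<i)) (trans (sym e) (rank-left p<i))))
  ... | tri> _ _ i<p | tri> _ _ i<q = ∸-cancelˡ-≡ (≤W p≤) (≤W q≤) (trans (sym (rank-right (<⇒≤ i<p))) (trans e (rank-right (<⇒≤ i<q))))
  ... | tri< p<i _ _ | tri> _ _ i<q = ⊥-elim (<-irrefl e (rank-left-right p<i i<q q≤))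
  ... | tri> _ _ i<p | tri< q<i _ _ = ⊥-elim (<-irrefl (sym e) (rank-left-right q<i i<p p≤))

  ≺ᵇ-true : ∀ {h h'} → h ≺ h' → (h ≺ᵇ h') ≡ true
  ≺ᵇ-true {h} {h'} = dec-true (key h <ₐ? key h')

  ≺ᵇ-false : ∀ {h h'} → ¬ h ≺ h' → (h ≺ᵇ h') ≡ false
  ≺ᵇ-false {h} {h'} = dec-false (key h <ₐ? key h')

  ≺ᵇ-true⇒ : ∀ {h h'} → (h ≺ᵇ h') ≡ true → h ≺ h'
  ≺ᵇ-true⇒ {h} {h'} e = invert (subst (Reflects (h ≺ h')) e (proof (key h <ₐ? key h')))

  -- position T h is the site at which the half-arc h has to sit
  #before : List Arc → Arc → ℕ
  #before T h = ∑ T (λ e → χ (e ≺ᵇ h) + χ (flip e ≺ᵇ h))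

  position : List Arc → Arc → ℕ
  position T h = proj₁ h + #before T h

  SeparatesCrossings : ℕ → List Arc → Set
  SeparatesCrossings n S =
    ∀ α β → α ∈ S → β ∈ S → Cross α β → ∀ x y → Supports x α → Supports y β → block n S x ≢ block n S y

  module PositionFormula {n : ℕ} {S : List Arc} (shape : P0Shape f n S) (separates : SeparatesCrossings n S) where
    open P0Shape shape

    bl : ℕ → ℕ
    bl = block n S

    blocks : Arc → Arc
    blocks (c , d) = (bl c , bl d)

    blocks-injective : ∀ {α β} → α ∈ S → β ∈ S → blocks α ≡ blocks β → α ≡ β
    blocks-injective {a , b} {c , d} mα mβ e with ≡-dec _≟_ _≟_ (a , b) (c , d)
    ... | yes eq = eq
    ... | no ne = ⊥-elim (<⇒≱ two (blockMatrix≤1 (s≤s z≤n) (blocks-< mα) (block≤suc-f mα)))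
      where
      g : Arc → ℕ
      g β = χ (joins n S (bl a) (bl b) β)
      two : 2 ≤ blockMatrix n S (bl a) (bl b)
      two = subst (2 ≤_) (sym (blockMatrix≡∑ n S (bl a) (bl b)))
              (two-terms≤∑ S g mα mβ ne (≤-reflexive (cong χ (sym (joins-own-blocks n S a b))))
                 (≤-reflexive (cong χ (sym (subst (λ h → joins n S (proj₁ h) (proj₂ h) (c , d) ≡ true) (sym e) (joins-own-blocks n S c d))))))

    HalfArcAt : Arc → ℕ → Arc → Set
    HalfArcAt (c , d) y h = (y ≡ c × h ≡ (bl c , bl d)) ⊎ (y ≡ d × h ≡ (bl d , bl c))

    HalfArcAt⇒Supports : ∀ {c d y h} → HalfArcAt (c , d) y h → Supports y (c , d)
    HalfArcAt⇒Supports (inj₁ (e , _)) = inj₁ e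
    HalfArcAt⇒Supports (inj₂ (e , _)) = inj₂ e

    HalfArcAt-block : ∀ {α y h} → HalfArcAt α y h → bl y ≡ proj₁ h
    HalfArcAt-block (inj₁ (refl , refl)) = refl
    HalfArcAt-block (inj₂ (refl , refl)) = refl

    -- Within one block, an order other than the one given by rank would create two crossing
    -- arcs with endpoints in a common block, or two arcs joining the same pair of blocks.
    HalfArcAt-<⇒≺ : ∀ {β α y x hy hx} → β ∈ S → α ∈ S → HalfArcAt β y hy → HalfArcAt α x hx → y < x → hy ≺ hx
    HalfArcAt-<⇒≺ {c , d} {a , b} mβ mα (inj₁ (refl , refl)) (inj₁ (refl , refl)) y<x with <-cmp (bl c) (bl a)
    ... | tri< p _ _ = inj₁ p
    ... | tri> _ _ p = ⊥-elim (<-asym y<x (block-<⇒< n S p))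
    ... | tri≈ _ e _ with <-cmp (bl d) (bl b)
    ...   | tri< p _ _ = ⊥-elim (separates (c , d) (a , b) mβ mα
              (inj₁ (y<x , block-<⇒< n S (subst (_< bl d) e (blocks-< mβ)) , block-<⇒< n S p)) c a (inj₁ refl) (inj₁ refl) e)
    ...   | tri≈ _ e₂ _ = ⊥-elim (<-irrefl (cong proj₁ (blocks-injective mβ mα (cong₂ _,_ e e₂))) y<x)
    ...   | tri> _ _ p = inj₂ (e , subst (λ z → rank (bl c) (bl d) < rank z (bl b)) e
                                     (rank-right-right (subst (_< bl b) (sym e) (blocks-< mα)) p (block≤suc-f mβ)))
    HalfArcAt-<⇒≺ {c , d} {a , b} mβ mα (inj₁ (refl , refl)) (inj₂ (refl , refl)) y<x with <-cmp (bl c) (bl b)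
    ... | tri< p _ _ = inj₁ p
    ... | tri> _ _ p = ⊥-elim (<-asym y<x (block-<⇒< n S p))
    ... | tri≈ _ e _ = ⊥-elim (separates (a , b) (c , d) mα mβ
            (inj₁ (block-<⇒< n S (subst (bl a <_) (sym e) (blocks-< mα)) , y<x , block-<⇒< n S (subst (_< bl d) e (blocks-< mβ))))
            b c (inj₂ refl) (inj₁ refl) (sym e))
    HalfArcAt-<⇒≺ {c , d} {a , b} mβ mα (inj₂ (refl , refl)) (inj₁ (refl , refl)) y<x with <-cmp (bl d) (bl a)
    ... | tri< p _ _ = inj₁ p
    ... | tri> _ _ p = ⊥-elim (<-asym y<x (block-<⇒< n S p))
    ... | tri≈ _ e _ = inj₂ (e , subst (λ z → rank (bl d) (bl c) < rank z (bl b)) e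
                                   (rank-left-right (blocks-< mβ) (subst (_< bl b) (sym e) (blocks-< mα)) (block≤suc-f mα)))
    HalfArcAt-<⇒≺ {c , d} {a , b} mβ mα (inj₂ (refl , refl)) (inj₂ (refl , refl)) y<x with <-cmp (bl d) (bl b)
    ... | tri< p _ _ = inj₁ p
    ... | tri> _ _ p = ⊥-elim (<-asym y<x (block-<⇒< n S p))
    ... | tri≈ _ e _ with <-cmp (bl c) (bl a)
    ...   | tri< p _ _ = ⊥-elim (separates (c , d) (a , b) mβ mα
              (inj₁ (block-<⇒< n S p , block-<⇒< n S (subst (bl a <_) (sym e) (blocks-< mα)) , y<x)) d b (inj₂ refl) (inj₂ refl) e)
    ...   | tri≈ _ e₂ _ = ⊥-elim (<-irrefl (cong proj₂ (blocks-injective mβ mα (cong₂ _,_ e₂ e))) y<x)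
    ...   | tri> _ _ p = inj₂ (e , subst (λ z → rank (bl d) (bl c) < rank z (bl a)) e (rank-left-left p (blocks-< mβ)))

    HalfArcAt-functional : ∀ {β α y hy hx} → β ∈ S → α ∈ S → HalfArcAt β y hy → HalfArcAt α y hx → hy ≡ hx
    HalfArcAt-functional {c , d} {a , b} mβ mα Eβ Eα
      with supporting-arc-unique deg≤1 mβ mα (HalfArcAt⇒Supports Eβ) (HalfArcAt⇒Supports Eα)
    ... | refl with Eβ | Eα
    ...   | inj₁ (_ , refl) | inj₁ (_ , refl) = refl
    ...   | inj₂ (_ , refl) | inj₂ (_ , refl) = refl
    ...   | inj₁ (refl , _) | inj₂ (e , _) = ⊥-elim (<-irrefl e (proj₁ (proj₂ (within (c , d) mβ))))
    ...   | inj₂ (refl , _) | inj₁ (e , _) = ⊥-elim (<-irrefl (sym e) (proj₁ (proj₂ (within (c , d) mβ))))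

    <ᵇ≡≺ᵇ : ∀ {β α y x hy hx} → β ∈ S → α ∈ S → HalfArcAt β y hy → HalfArcAt α x hx → (y <ᵇ x) ≡ (hy ≺ᵇ hx)
    <ᵇ≡≺ᵇ {y = y} {x} {hy} {hx} mβ mα Eβ Eα with <-cmp y x
    ... | tri< y<x _ _ = trans (<⇒<ᵇ-true y<x) (sym (≺ᵇ-true (HalfArcAt-<⇒≺ mβ mα Eβ Eα y<x)))
    ... | tri≈ _ refl _ = trans (≥⇒<ᵇ-false {x} {x} ≤-refl)
                                (sym (subst (λ h → (h ≺ᵇ hx) ≡ false) (sym (HalfArcAt-functional mβ mα Eβ Eα)) (≺ᵇ-false {hx} {hx} ≺-irrefl)))
    ... | tri> _ _ x<y = trans (≥⇒<ᵇ-false {y} {x} (<⇒≤ x<y)) (sym (≺ᵇ-false {hy} {hx} (≺-asym (HalfArcAt-<⇒≺ mα mβ Eα Eβ x<y))))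

    ∑-blocks : ∀ (F : Arc → ℕ) → ∑ S (λ β → F (blocks β)) ≡ ∑ (Ψ n S) F
    ∑-blocks F = trans (sym (∑-map blocks S F))
      (∑-cong-∈ (map blocks S) (Ψ n S)
        (Unique-map⁺ blocks (Sorted⇒Unique sorted) blocks-injective)
        (Sorted⇒Unique (Ψ-sorted n S))
        (λ m → let (β , mβ , e) = ∈-map⁻ blocks m in subst (_∈ Ψ n S) (sym e) (arc⇒∈Ψ shape mβ))
        (λ m → let (α , mα , e) = ∈Ψ⇒arc shape m in subst (_∈ map blocks S) e (∈-map⁺ blocks mα))
        F)

    endsBelow≡#before : ∀ {α x hx} → α ∈ S → HalfArcAt α x hx → endsBelow S x ≡ #before (Ψ n S) hx
    endsBelow≡#before {α} {x} {hx} mα Eα = trans (∑-cong S each) (∑-blocks (λ e → χ (e ≺ᵇ hx) + χ (flip e ≺ᵇ hx)))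
      where
      each : ∀ β → β ∈ S → χ (proj₁ β <ᵇ x) + χ (proj₂ β <ᵇ x) ≡ χ (blocks β ≺ᵇ hx) + χ (flip (blocks β) ≺ᵇ hx)
      each (c , d) mβ = cong₂ (λ u v → χ u + χ v) (<ᵇ≡≺ᵇ mβ mα (inj₁ (refl , refl)) Eα) (<ᵇ≡≺ᵇ mβ mα (inj₂ (refl , refl)) Eα)

    HalfArcAt-range : ∀ {α x h} → α ∈ S → HalfArcAt α x h → 1 ≤ x × x ≤ n
    HalfArcAt-range {c , d} mα (inj₁ (refl , _)) = let (1≤c , c<d , d≤n) = within (c , d) mα in 1≤c , ≤-trans (<⇒≤ c<d) d≤n
    HalfArcAt-range {c , d} mα (inj₂ (refl , _)) = let (1≤c , c<d , d≤n) = within (c , d) mα in ≤-trans 1≤c (<⇒≤ c<d) , d≤n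

    position-formula : ∀ {α x hx} → α ∈ S → HalfArcAt α x hx → x ≡ position (Ψ n S) hx
    position-formula {α} {x} {hx} mα Eα = begin
      x                                     ≡⟨ trans (sym (m∸n+n≡m 1≤x)) (+-comm (x ∸ 1) 1) ⟩
      suc (x ∸ 1)                           ≡⟨ cong suc (trans (nFreeBelow+endsBelow n S x within deg≤1)
                                                               (m≤n⇒m⊓n≡m (≤-trans (m∸n≤m x 1) x≤n))) ⟨
      suc (nFreeBelow n S x + endsBelow S x) ≡⟨ cong₂ _+_ (HalfArcAt-block Eα) (endsBelow≡#before mα Eα) ⟩
      position (Ψ n S) hx                   ∎
      where
      open ≡-Reasoning
      1≤x = proj₁ (HalfArcAt-range mα Eα)
      x≤n = proj₂ (HalfArcAt-range mα Eα)

  Ψ-injective-on-arcs : ∀ {n S n' S'} → P0Shape f n S → SeparatesCrossings n S → P0Shape f n' S' → SeparatesCrossings n' S' →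
                        Ψ n S ≡ Ψ n' S' → S ⊆ S'
  Ψ-injective-on-arcs {n} {S} {n'} {S'} shape sep shape' sep' Ψ≡ {a , b} m
    with ∈Ψ⇒arc shape' (subst ((block n S a , block n S b) ∈_) Ψ≡ (arc⇒∈Ψ shape m))
  ... | ((a' , b') , m' , e) = subst (_∈ S') (sym (cong₂ _,_ a≡a' b≡b')) m'
    where
    module P = PositionFormula shape sep
    module P' = PositionFormula shape' sep'
    a≡a' : a ≡ a'
    a≡a' = trans (P.position-formula m (inj₁ (refl , refl)))
                 (trans (cong₂ position Ψ≡ (sym e)) (sym (P'.position-formula m' (inj₁ (refl , refl)))))
    b≡b' : b ≡ b'
    b≡b' = trans (P.position-formula m (inj₂ (refl , refl)))
                 (trans (cong₂ position Ψ≡ (cong flip (sym e))) (sym (P'.position-formula m' (inj₂ (refl , refl)))))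

  ≺-crossing⇒Cross : ∀ {i j i' j'} → i < j → i' < j' → j' ≤ suc f →
                     (i , j) ≺ (i' , j') → (i' , j') ≺ (j , i) → (j , i) ≺ (j' , i') → i < i' × i' < j × j < j'
  ≺-crossing⇒Cross {i} {j} {i'} {j'} i<j i'<j' j'≤ K₁ K₂ K₃ = i<i' K₁ K₃ , i'<j K₂ , j<j' K₃
    where
    ∸-reflects-< : ∀ {x a b} → x ∸ a < x ∸ b → b < a
    ∸-reflects-< {x} {a} {b} lt with <-cmp b a
    ... | tri< p _ _ = p
    ... | tri≈ _ refl _ = ⊥-elim (<-irrefl refl lt)
    ... | tri> _ _ p = ⊥-elim (<⇒≱ lt (∸-monoʳ-≤ x (<⇒≤ p)))
    i<i' : (i , j) ≺ (i' , j') → (j , i) ≺ (j' , i') → i < i'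
    i<i' (inj₁ p) _ = p
    i<i' (inj₂ (refl , p)) K with ∸-reflects-< {W} {j} {j'} (subst₂ _<_ (rank-right (<⇒≤ i<j)) (rank-right (<⇒≤ i'<j')) p)
    ... | j'<j with K
    ...   | inj₁ q = ⊥-elim (<-asym q j'<j)
    ...   | inj₂ (refl , _) = ⊥-elim (<-irrefl refl j'<j)
    i'<j : (i' , j') ≺ (j , i) → i' < j
    i'<j (inj₁ p) = p
    i'<j (inj₂ (refl , p)) = ⊥-elim (<-asym p (rank-left-right i<j i'<j' j'≤))
    j<j' : (j , i) ≺ (j' , i') → j < j'
    j<j' (inj₁ p) = p
    j<j' (inj₂ (refl , p)) = ⊥-elim (<-asym (i<i' K₁ K₃) (∸-reflects-< {j} {i} {i'} (subst₂ _<_ (rank-left i<j) (rank-left i'<j') p)))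

  -- Surjectivity on ℛ⁰

  -- The preimage of T: every half-arc h of T is placed at site position T h.
  module Preimage {k : ℕ} (T : List Arc) (sd : SD (suc f) k T) where

    valid : All (ValidArc (suc f)) T
    valid = proj₁ (proj₁ sd)
    sortedT : Sorted T
    sortedT = Linked⇒Sorted (proj₂ (proj₁ sd))
    increasing : Increasing T
    increasing = ValidArcs⇒Increasing valid

    IsHalfArc : Arc → Set
    IsHalfArc h = ∃ λ e → e ∈ T × (h ≡ e ⊎ h ≡ flip e)

    first-half : ∀ {e} → e ∈ T → IsHalfArc e
    first-half {e} m = e , m , inj₁ refl
    second-half : ∀ {e} → e ∈ T → IsHalfArc (flip e)
    second-half {e} m = e , m , inj₂ refl

    IsHalfArc-range : ∀ {h} → IsHalfArc h → 1 ≤ proj₁ h × proj₁ h ≤ suc f × proj₂ h ≤ suc f × proj₂ h ≢ proj₁ h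
    IsHalfArc-range ((i , j) , m , inj₁ refl) = let (1≤i , i<j , j≤ , _) = All.lookup valid m in
      1≤i , ≤-trans (<⇒≤ i<j) j≤ , j≤ , (λ e → <-irrefl (sym e) i<j)
    IsHalfArc-range ((i , j) , m , inj₂ refl) = let (1≤i , i<j , j≤ , _) = All.lookup valid m in
      ≤-trans 1≤i (<⇒≤ i<j) , j≤ , ≤-trans (<⇒≤ i<j) j≤ , (λ e → <-irrefl e i<j)

    ≺-total : ∀ {h h'} → IsHalfArc h → IsHalfArc h' → h ≢ h' → h ≺ h' ⊎ h' ≺ h
    ≺-total {i , p} {i' , p'} H H' ne with <-cmp i i'
    ... | tri< lt _ _ = inj₁ (inj₁ lt)
    ... | tri> _ _ gt = inj₂ (inj₁ gt)
    ... | tri≈ _ refl _ with <-cmp (rank i p) (rank i p')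
    ...   | tri< lt _ _ = inj₁ (inj₂ (refl , lt))
    ...   | tri> _ _ gt = inj₂ (inj₂ (refl , gt))
    ...   | tri≈ _ e _ = let (_ , _ , p≤ , p≢) = IsHalfArc-range H ; (_ , _ , p'≤ , p'≢) = IsHalfArc-range H' in
                         ⊥-elim (ne (cong (i ,_) (rank-injective p≢ p'≢ p≤ p'≤ e)))

    pos : Arc → ℕ
    pos = position T

    precedes : Arc → Arc → ℕ
    precedes h e = χ (e ≺ᵇ h) + χ (flip e ≺ᵇ h)

    ≺ᵇ-mono : ∀ {h h'} → h ≺ h' → ∀ x → χ (x ≺ᵇ h) ≤ χ (x ≺ᵇ h')
    ≺ᵇ-mono k x = χ-mono (λ t → ≺ᵇ-true (≺-trans (≺ᵇ-true⇒ t) k))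

    χ-≺ᵇ-self< : ∀ {h h'} → h ≺ h' → χ (h ≺ᵇ h) < χ (h ≺ᵇ h')
    χ-≺ᵇ-self< {h} {h'} k rewrite ≺ᵇ-false {h} {h} ≺-irrefl | ≺ᵇ-true k = s≤s z≤n

    position-strictMono : ∀ {h h'} → IsHalfArc h → h ≺ h' → pos h < pos h'
    position-strictMono {h} {h'} (e , m , which) k =
      +-mono-≤-< (≺⇒block≤ k) (∑-< T (precedes h) (precedes h') (λ x _ → +-mono-≤ (≺ᵇ-mono k x) (≺ᵇ-mono k (flip x))) m (at-e which))
      where
      at-e : (h ≡ e ⊎ h ≡ flip e) → precedes h e < precedes h' e
      at-e (inj₁ refl) = +-mono-<-≤ (χ-≺ᵇ-self< k) (≺ᵇ-mono k (flip e))
      at-e (inj₂ refl) = +-mono-≤-< (≺ᵇ-mono k e) (χ-≺ᵇ-self< k)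

    position-injective : ∀ {h h'} → IsHalfArc h → IsHalfArc h' → pos h ≡ pos h' → h ≡ h'
    position-injective {h} {h'} H H' e with ≡-dec _≟_ _≟_ h h'
    ... | yes q = q
    ... | no ne with ≺-total H H' ne
    ...   | inj₁ k = ⊥-elim (<-irrefl e (position-strictMono H k))
    ...   | inj₂ k = ⊥-elim (<-irrefl (sym e) (position-strictMono H' k))

    position-reflects : ∀ {h h'} → IsHalfArc h → IsHalfArc h' → pos h < pos h' → h ≺ h'
    position-reflects {h} {h'} H H' lt with ≡-dec _≟_ _≟_ h h'
    ... | yes refl = ⊥-elim (<-irrefl refl lt)
    ... | no ne with ≺-total H H' ne
    ...   | inj₁ k = k
    ...   | inj₂ k = ⊥-elim (<-asym lt (position-strictMono H' k))

    <ᵇ-position : ∀ {h h'} → IsHalfArc h → IsHalfArc h' → (pos h <ᵇ pos h') ≡ (h ≺ᵇ h')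
    <ᵇ-position {h} {h'} H H' with <ᵇ-view (pos h) (pos h')
    ... | inj₁ (e , lt) = trans e (sym (≺ᵇ-true (position-reflects H H' lt)))
    ... | inj₂ (e , ge) = trans e (sym (≺ᵇ-false (λ k → <⇒≱ (position-strictMono H k) ge)))

    position-range : ∀ {h} → IsHalfArc h → 1 ≤ pos h × pos h ≤ f + 2 * length T
    position-range {h} H@(e , m , which) = let (1≤i , i≤ , _) = IsHalfArc-range H in
      ≤-trans 1≤i (m≤m+n _ _) ,
      (begin
        proj₁ h + ∑ T (precedes h)                 ≡⟨ cong (proj₁ h +_) (∑-removeArc e T (precedes h) (Sorted⇒Unique sortedT) m) ⟩
        proj₁ h + (precedes h e + ∑ rest (precedes h))
          ≤⟨ +-mono-≤ i≤ (+-mono-≤ (at-e which) (∑-mono rest (λ x _ → +-mono-≤ (χ≤1 (x ≺ᵇ h)) (χ≤1 (flip x ≺ᵇ h))))) ⟩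
        suc f + (1 + ∑ rest (λ _ → 2))             ≡⟨ cong (λ z → suc f + (1 + z)) (∑-const rest 2) ⟩
        suc f + (1 + 2 * length rest)              ≡⟨ +-suc f (suc (2 * length rest)) ⟨
        f + suc (suc (2 * length rest))            ≡⟨ cong (f +_) (*-suc 2 (length rest)) ⟨
        f + 2 * suc (length rest)                  ≡⟨ cong (λ z → f + 2 * z) (length-removeArc e T (Sorted⇒Unique sortedT) m) ⟩
        f + 2 * length T                           ∎)
      where
      open ≤-Reasoning
      rest = removeArc e T
      at-e : (h ≡ e ⊎ h ≡ flip e) → precedes h e ≤ 1
      at-e (inj₁ refl) rewrite ≺ᵇ-false {h} {h} ≺-irrefl = χ≤1 (flip h ≺ᵇ h)
      at-e (inj₂ refl) rewrite ≺ᵇ-false {flip e} {flip e} ≺-irrefl = subst (_≤ 1) (sym (+-identityʳ _)) (χ≤1 (e ≺ᵇ flip e))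

    n₀ : ℕ
    n₀ = f + 2 * length T

    arcAt : Arc → Arc
    arcAt e = (pos e , pos (flip e))

    S₀ : List Arc
    S₀ = filter (_∈? map arcAt T) (pairs n₀)

    ∈S₀⁺ : ∀ {e} → e ∈ T → arcAt e ∈ S₀
    ∈S₀⁺ m = ∈-filter⁺ (_∈? map arcAt T)
      (∈-pairs⁺ n₀ (proj₁ (position-range (first-half m))) (position-strictMono (first-half m) (inj₁ (increasing m)))
                   (proj₂ (position-range (second-half m))))
      (∈-map⁺ arcAt m)

    ∈S₀⁻ : ∀ {β} → β ∈ S₀ → ∃ λ e → e ∈ T × β ≡ arcAt e
    ∈S₀⁻ m = ∈-map⁻ arcAt (proj₂ (∈-filter⁻ (_∈? map arcAt T) {xs = pairs n₀} m))

    within₀ : ArcsWithin n₀ S₀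
    within₀ β m = ∈-pairs⁻ n₀ (proj₁ (∈-filter⁻ (_∈? map arcAt T) {xs = pairs n₀} m))

    sorted₀ : Sorted S₀
    sorted₀ = APP.filter⁺ (_∈? map arcAt T) (pairs-sorted n₀)

    endpoint-injective : ∀ {e e' h h'} → e ∈ T → e' ∈ T → (h ≡ e ⊎ h ≡ flip e) → (h' ≡ e' ⊎ h' ≡ flip e') →
                         pos h ≡ pos h' → e ≡ e'
    endpoint-injective {e} {e'} m m' w w' eq with position-injective (e , m , w) (e' , m' , w') eq
    ... | refl with w | w'
    ...   | inj₁ e₁ | inj₁ e₂ = trans (sym e₁) e₂
    ...   | inj₂ e₁ | inj₂ e₂ = flip-injective (trans (sym e₁) e₂)
    ...   | inj₁ e₁ | inj₂ e₂ = ⊥-elim (<-asym (increasing m) (subst (λ z → proj₂ z < proj₁ z) (sym (trans (sym e₁) e₂)) (increasing m')))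
    ...   | inj₂ e₁ | inj₁ e₂ = ⊥-elim (<-asym (increasing m') (subst (λ z → proj₂ z < proj₁ z) (trans (sym e₁) e₂) (increasing m)))

    ∑-S₀ : ∀ (g : Arc → ℕ) → ∑ S₀ g ≡ ∑ T (λ e → g (arcAt e))
    ∑-S₀ g = trans (∑-cong-∈ S₀ (map arcAt T) (Sorted⇒Unique sorted₀)
        (Unique-map⁺ arcAt (Sorted⇒Unique sortedT) (λ m m' q → endpoint-injective m m' (inj₁ refl) (inj₁ refl) (cong proj₁ q)))
        (λ m → let (e , me , q) = ∈S₀⁻ m in subst (_∈ map arcAt T) (sym q) (∈-map⁺ arcAt me))
        (λ m → let (e , me , q) = ∈-map⁻ arcAt m in subst (_∈ S₀) (sym q) (∈S₀⁺ me)) g)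
      (∑-map arcAt T g)

    length-S₀ : length S₀ ≡ length T
    length-S₀ = trans (sym (∑1≡length S₀)) (trans (∑-S₀ (λ _ → 1)) (∑1≡length T))

    deg≤1₀ : Deg≤1 S₀
    deg≤1₀ u = subst (_≤ 1) (sym (deg≡∑arcDeg S₀ u))
      (∑≤1 S₀ (arcDeg u) (Sorted⇒Unique sorted₀) (λ { (c , d) m → arcDeg≤1 u (proj₁ (proj₂ (within₀ _ m))) }) same)
      where
      at : ∀ {e} → Supports u (arcAt e) → ∃ λ h → (h ≡ e ⊎ h ≡ flip e) × u ≡ pos h
      at {e} (inj₁ q) = e , inj₁ refl , q
      at {e} (inj₂ q) = flip e , inj₂ refl , q
      same : ∀ {β γ} → β ∈ S₀ → γ ∈ S₀ → 1 ≤ arcDeg u β → 1 ≤ arcDeg u γ → β ≡ γ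
      same mβ mγ gβ gγ with ∈S₀⁻ mβ | ∈S₀⁻ mγ
      ... | (e , me , refl) | (e' , me' , refl) with at {e} (1≤arcDeg⇒Supports gβ) | at {e'} (1≤arcDeg⇒Supports gγ)
      ...   | (h , w , q) | (h' , w' , q') = cong arcAt (endpoint-injective me me' w w' (trans (sym q) q'))

    endsBelow-S₀ : ∀ {h} → IsHalfArc h → endsBelow S₀ (pos h) ≡ #before T h
    endsBelow-S₀ {h} H = trans (∑-S₀ (λ β → χ (proj₁ β <ᵇ pos h) + χ (proj₂ β <ᵇ pos h)))
      (∑-cong T (λ e m → cong₂ (λ x y → χ x + χ y) (<ᵇ-position (first-half m) H) (<ᵇ-position (second-half m) H)))

    nFreeBelow-S₀ : ∀ {h} → IsHalfArc h → nFreeBelow n₀ S₀ (pos h) ≡ proj₁ h ∸ 1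
    nFreeBelow-S₀ {h} H = +-cancelʳ-≡ (#before T h) _ _ (begin
      nFreeBelow n₀ S₀ (pos h) + #before T h         ≡⟨ cong (nFreeBelow n₀ S₀ (pos h) +_) (endsBelow-S₀ H) ⟨
      nFreeBelow n₀ S₀ (pos h) + endsBelow S₀ (pos h) ≡⟨ nFreeBelow+endsBelow n₀ S₀ (pos h) within₀ deg≤1₀ ⟩
      (pos h ∸ 1) ⊓ n₀                               ≡⟨ m≤n⇒m⊓n≡m (≤-trans (m∸n≤m (pos h) 1) (proj₂ (position-range H))) ⟩
      pos h ∸ 1                                      ≡⟨ +-∸-comm (#before T h) (proj₁ (IsHalfArc-range H)) ⟩
      proj₁ h ∸ 1 + #before T h                      ∎)
      where open ≡-Reasoning

    block-S₀ : ∀ {h} → IsHalfArc h → block n₀ S₀ (pos h) ≡ proj₁ h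
    block-S₀ {h} H = trans (cong suc (nFreeBelow-S₀ H)) (trans (+-comm 1 (proj₁ h ∸ 1)) (m∸n+n≡m (proj₁ (IsHalfArc-range H))))

    nFree-S₀ : nFree n₀ S₀ ≡ f
    nFree-S₀ = +-cancelʳ-≡ (2 * length T) _ _
      (trans (cong (λ z → nFree n₀ S₀ + 2 * z) (sym length-S₀)) (nFree+2*arcs≡length n₀ S₀ within₀ deg≤1₀))

    block-arcAt : ∀ {e x} → e ∈ T → Supports x (arcAt e) → Supports (block n₀ S₀ x) e
    block-arcAt m (inj₁ refl) = inj₁ (block-S₀ (first-half m))
    block-arcAt m (inj₂ refl) = inj₂ (block-S₀ (second-half m))

    covers₀ : ∀ β → β ∈ S₀ → ∃ λ s → Free n₀ S₀ s × Covered s β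
    covers₀ β m with ∈S₀⁻ m
    ... | (e , me , refl) = nFreeBelow-<⇒covered n₀ S₀ m
      (subst₂ _<_ (sym (nFreeBelow-S₀ (first-half me))) (sym (nFreeBelow-S₀ (second-half me)))
              (∸-monoˡ-< (increasing me) (proj₁ (All.lookup valid me))))

    ¬first-to-last₀ : ∀ {c d} → (c , d) ∈ S₀ → block n₀ S₀ c ≡ 1 → block n₀ S₀ d ≢ suc (nFree n₀ S₀)
    ¬first-to-last₀ m first last with ∈S₀⁻ m
    ... | (e , me , refl) =
      <-irrefl (cong₂ _∸_ (trans (sym (block-S₀ (second-half me))) (trans last (cong suc nFree-S₀)))
                          (trans (sym (block-S₀ (first-half me))) first))
               (proj₂ (proj₂ (proj₂ (proj₂ (All.lookup valid me)))))

    arcAt-cross : ∀ {e e'} → e ∈ T → e' ∈ T → Cross (arcAt e) (arcAt e') → Cross e e'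
    arcAt-cross {i , j} {i' , j'} m m' (inj₁ (p , q , r)) =
      inj₁ (≺-crossing⇒Cross (increasing m) (increasing m') (proj₁ (proj₂ (proj₂ (All.lookup valid m'))))
        (position-reflects (first-half m) (first-half m') p) (position-reflects (first-half m') (second-half m) q)
        (position-reflects (second-half m) (second-half m') r))
    arcAt-cross {i , j} {i' , j'} m m' (inj₂ (p , q , r)) =
      inj₂ (≺-crossing⇒Cross (increasing m') (increasing m) (proj₁ (proj₂ (proj₂ (All.lookup valid m))))
        (position-reflects (first-half m') (first-half m) p) (position-reflects (first-half m) (second-half m') q)
        (position-reflects (second-half m') (second-half m) r))

    blockMatrix-S₀ : ∀ i j → blockMatrix n₀ S₀ i j ≡ ∑ T (λ e → χ (adjacent i j e))
    blockMatrix-S₀ i j = trans (blockMatrix≡∑ n₀ S₀ i j) (trans (∑-S₀ (λ β → χ (joins n₀ S₀ i j β)))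
      (∑-cong T (λ { (c , d) m → cong₂ (λ x y → χ (((x ≡ᵇ i) ∧ (y ≡ᵇ j)) ∨ ((x ≡ᵇ j) ∧ (y ≡ᵇ i))))
                                        (block-S₀ (first-half m)) (block-S₀ (second-half m)) })))

    blockMatrix-S₀≤1 : ∀ {i j} → i < j → blockMatrix n₀ S₀ i j ≤ 1
    blockMatrix-S₀≤1 {i} {j} i<j = subst (_≤ 1) (sym (blockMatrix-S₀ i j)) (∑≤1 T _ (Sorted⇒Unique sortedT) (λ e _ → χ≤1 _)
      (λ mx my gx gy → trans (adjacent∈⇒ increasing i<j mx (χ-pos⇒true gx)) (sym (adjacent∈⇒ increasing i<j my (χ-pos⇒true gy)))))

    blockMatrix-S₀-adjacent : ∀ i → blockMatrix n₀ S₀ i (suc i) ≡ 0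
    blockMatrix-S₀-adjacent i = trans (blockMatrix-S₀ i (suc i)) (∑-zero T _ none)
      where
      suc-∸-self : ∀ i → suc i ∸ i ≡ 1
      suc-∸-self zero = refl
      suc-∸-self (suc i) = suc-∸-self i
      none : ∀ e → e ∈ T → χ (adjacent i (suc i) e) ≡ 0
      none e m with adjacent i (suc i) e in q
      ... | false = refl
      ... | true with adjacent∈⇒ increasing (n<1+n i) m q
      ...   | refl = ⊥-elim (<-irrefl (sym (suc-∸-self i)) (proj₁ (proj₂ (proj₂ (proj₂ (All.lookup valid m))))))

    R0-S₀ : R0 f k n₀ S₀
    R0-S₀ =
      ((tabulate (λ m → covered∧¬first-to-last⇒ValidArc within₀ m (covers₀ _ m) (¬first-to-last₀ m)) , Sorted⇒Linked sorted₀) ,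
       ((nonTrivial₀ , deg≤1₀) , covers₀ , (λ β m → ¬first-to-last⇒¬covers-all m (¬first-to-last₀ m))) ,
       KNoncrossing-reflect (λ e β → β ≡ arcAt e × e ∈ T) (λ m → let (e , me , q) = ∈S₀⁻ m in e , me , q , me)
                            (λ { (refl , m) (refl , m') c → arcAt-cross m m' c }) (proj₂ (proj₂ sd)) ,
       nFree-S₀ ,
       trans (cong (λ g → tautologyOf g (blockMatrix n₀ S₀)) nFree-S₀)
             (tautologyOf≡0⇐ f _ (λ _ i<j → blockMatrix-S₀≤1 i<j) blockMatrix-S₀-adjacent)) ,
      ((nonTrivial₀ , deg≤1₀) , regular₀)
      where
      nonTrivial₀ : NonTrivial S₀
      nonTrivial₀ = mem⇒nonempty (∈S₀⁺ (proj₂ (nonempty⇒∃∈ (proj₁ (proj₂ sd)))))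
      regular₀ : ∀ β γ → β ∈ S₀ → γ ∈ S₀ → Cross β γ → ∀ x y → Supports x β → Supports y γ → block n₀ S₀ x ≢ block n₀ S₀ y
      regular₀ β γ mβ mγ cr x y sx sy with ∈S₀⁻ mβ | ∈S₀⁻ mγ
      ... | (e , me , refl) | (e' , me' , refl) =
        Cross⇒supports-disjoint (arcAt-cross me me' cr) (block-arcAt me sx) (block-arcAt me' sy)

    Ψ-S₀ : Ψ n₀ S₀ ≡ T
    Ψ-S₀ = Sorted-extensional (Ψ n₀ S₀) T (Ψ-sorted n₀ S₀) sortedT Ψ⊆T T⊆Ψ
      where
      Ψ⊆T : ∀ {e} → e ∈ Ψ n₀ S₀ → e ∈ T
      Ψ⊆T {i , j} m with ∈Ψ⁻ {n₀} {S₀} m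
      ... | (_ , i<j , _ , b) with ∑-pos⇒ T _ (subst (1 ≤_) (blockMatrix-S₀ i j) b)
      ...   | (e , me , g) = subst (_∈ T) (adjacent∈⇒ increasing i<j me (χ-pos⇒true g)) me
      T⊆Ψ : ∀ {e} → e ∈ T → e ∈ Ψ n₀ S₀
      T⊆Ψ {i , j} m = let (1≤i , i<j , j≤ , _) = All.lookup valid m in
        ∈Ψ⁺ {n₀} {S₀} 1≤i i<j j≤ (subst (1 ≤_) (sym (blockMatrix-S₀ i j))
          (≤-trans (≤-reflexive (cong χ (sym (adjacent-self i j)))) (term≤∑ T (λ e → χ (adjacent i j e)) m)))

  Ψ-onto-ℛ⁰ : ∀ {k} T → SD (suc f) k T → ∃ λ n → ∃ λ S → R0 f k n S × Ψ n S ≡ T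
  Ψ-onto-ℛ⁰ T sd = n₀ , S₀ , R0-S₀ , Ψ-S₀
    where open Preimage T sd

  Ψ-monotone : ∀ {k n S n' S'} → P0 f k n' S' → (n , S) ≼ (n' , S') → Ψ n S ⊆ Ψ n' S'
  Ψ-monotone P' = Ψ-≼-mono within sorted deg≤1
    where open P0Shape (P0⇒P0Shape P')

  Ψ-injective : ∀ {k n S n' S'} → R0 f k n S → R0 f k n' S' → Ψ n S ≡ Ψ n' S' → (n ≡ n') × (S ≡ S')
  Ψ-injective {n = n} {S} {n'} {S'} (P , (_ , sep)) (P' , (_ , sep')) Ψ≡ = n≡n' , S≡S'
    where
    shape = P0⇒P0Shape P
    shape' = P0⇒P0Shape P'
    open P0Shape
    S≡S' : S ≡ S'
    S≡S' = Sorted-extensional S S' (sorted shape) (sorted shape')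
             (Ψ-injective-on-arcs shape sep shape' sep' Ψ≡) (Ψ-injective-on-arcs shape' sep' shape sep (sym Ψ≡))
    n≡n' : n ≡ n'
    n≡n' = trans (sym (nFree+2*arcs≡length n S (within shape) (deg≤1 shape)))
                 (trans (cong₂ (λ x L → x + 2 * length L) (trans (nFree≡f shape) (sym (nFree≡f shape'))) S≡S')
                        (nFree+2*arcs≡length n' S' (within shape') (deg≤1 shape')))

  -- An arc of S' whose pair of blocks is not in Ψ S can be suppressed without leaving ℛ⁰ or
  -- losing a pair of Ψ S; repeating this reaches S itself, by injectivity.
  Ψ-⊆⇒≼ : ∀ {k} m {n S n' S'} → length S' ≤ m → R0 f k n S → R0 f k n' S' → Ψ n S ⊆ Ψ n' S' → (n , S) ≼ (n' , S')
  Ψ-⊆⇒≼ m {n} {S} {n'} {S'} len R R' Ψ⊆ with ⊆-or-counterexample (Ψ n' S') (Ψ n S)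
  ... | inj₁ Ψ⊇ with Ψ-injective R R' (Sorted-extensional _ _ (Ψ-sorted n S) (Ψ-sorted n' S') Ψ⊆ Ψ⊇)
  ...   | (refl , refl) = ≼-refl
  Ψ-⊆⇒≼ zero len R R' Ψ⊆ | inj₂ (e , me , _) =
    ⊥-elim (<⇒≱ (mem⇒nonempty (proj₁ (proj₂ (∈Ψ⇒arc (P0⇒P0Shape (proj₁ R')) me)))) len)
  Ψ-⊆⇒≼ (suc m) {n} {S} {n'} {S'} len R R' Ψ⊆ | inj₂ (e , me , e∉) with ∈Ψ⇒arc (P0⇒P0Shape (proj₁ R')) me
  ... | ((a , b) , mab , refl) = ≼-step mab (Ψ-⊆⇒≼ m len' R R'' Ψ⊆X')
    where
    shape' = P0⇒P0Shape (proj₁ R')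
    module Sup = Suppression (P0Shape.within shape') (P0Shape.sorted shape') (P0Shape.deg≤1 shape') mab
    survives : ∀ {e'} → e' ∈ Ψ n S → ∃ λ β → β ∈ S' × β ≢ (a , b) × (block n' S' (proj₁ β) , block n' S' (proj₂ β)) ≡ e'
    survives m' with ∈Ψ⇒arc shape' (Ψ⊆ m')
    ... | ((c , d) , mcd , refl) = (c , d) , mcd , (λ { refl → e∉ m' }) , refl
    nonTrivial : NonTrivial Sup.X'
    nonTrivial = let (β , mβ , β≢ , _) = survives (proj₂ (nonempty⇒∃∈ (proj₁ (proj₂ (proj₁ (Ψ-wellDefined (proj₁ R))))))) in
                 mem⇒nonempty (Sup.∈-X'⁺ mβ β≢)
    R'' = R0-suppress R' mab nonTrivial
    Ψ⊆X' : Ψ n S ⊆ Ψ (n' ∸ 2) Sup.X'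
    Ψ⊆X' m' with survives m'
    ... | ((c , d) , mβ , β≢ , refl) = let (av₁ , av₂) = Sup.others-avoid mβ β≢ in
      subst (_∈ Ψ (n' ∸ 2) Sup.X') (cong₂ _,_ (Sup.block-X' av₁) (Sup.block-X' av₂))
            (arc⇒∈Ψ (P0⇒P0Shape (proj₁ R'')) (Sup.∈-X'⁺ mβ β≢))
    len' : length Sup.X' ≤ m
    len' = ≤-pred (subst (_≤ suc m) (sym Sup.length-X') len)

theorem7p4 : (f k : ℕ) → 3 ≤ f → 1 ≤ k →
    Σ (ℕ → List Arc → List Arc) λ Ψ →
    (∀ n S → P0 f k n S → SD (suc f) k (Ψ n S) × AdjEq (suc f) (Ψ n S) (blockMatrix n S))
    × (∀ n S → P0 f k n S → ∀ T → IsDiagram (suc f) T → AdjEq (suc f) T (blockMatrix n S) → T ≡ Ψ n S)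
    × (∀ T → SD (suc f) k T → ∃ λ n → ∃ λ S → P0 f k n S × Ψ n S ≡ T)
    × (∀ n S n' S' → P0 f k n S → P0 f k n' S' → (n , S) ≼ (n' , S') → Ψ n S ⊆ Ψ n' S')
    × (∀ T → SD (suc f) k T → ∃ λ n → ∃ λ S → R0 f k n S × Ψ n S ≡ T)
    × (∀ n S n' S' → R0 f k n S → R0 f k n' S' → Ψ n S ≡ Ψ n' S' → (n ≡ n') × (S ≡ S'))
    × (∀ n S n' S' → R0 f k n S → R0 f k n' S' → ((n , S) ≼ (n' , S') ⇔ (Ψ n S ⊆ Ψ n' S')))
theorem7p4 f k _ _ =
  Ψ f ,
  (λ _ _ → Ψ-wellDefined f) ,
  (λ n S _ → Ψ-unique f n S) ,
  (λ T sd → let (n , S , R , e) = Ψ-onto-ℛ⁰ f T sd in n , S , proj₁ R , e) ,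
  (λ _ _ _ _ _ → Ψ-monotone f) ,
  Ψ-onto-ℛ⁰ f ,
  (λ _ _ _ _ → Ψ-injective f) ,
  (λ _ _ _ S' R R' → mk⇔ (Ψ-monotone f (proj₁ R')) (Ψ-⊆⇒≼ f (length S') ≤-refl R R'))
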